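{- Let $\tau,\tau'$ be closed types and $f\in\mathrm{Val}((\tau\to\tau')\to\tau\to\tau')$. Suppose that for every $g\in\mathrm{Val}(\tau\to\tau')$ there is a value $f_g$ with $f\,g\overset{p}{\leadsto} f_g$. Then $f\,(\mathsf{fix}[\tau][\tau']\,f)\cong^{ctx}_{\Downarrow}\mathsf{fix}[\tau][\tau']\,f$ and $f\,(\mathsf{fix}[\tau][\tau']\,f)\cong^{ctx}_{\downarrow}\mathsf{fix}[\tau][\tau']\,f$ (as closed terms of type $\tau\to\tau'$).
   Context: Language. Types: $\tau ::= \alpha \mid \mathbf{1} \mid \tau_1\times\tau_2 \mid \tau_1\to\tau_2 \mid \mu\alpha.(\tau_1+\dots+\tau_n) \mid \forall\alpha.\tau$. Values: $v ::= x \mid \langle\rangle \mid \langle v_1,v_2\rangle \mid \lambda x.e \mid \mathsf{in}_i\,v \mid \Lambda\alpha.e$. Terms: $e ::= v \mid ? \mid \mathsf{proj}_i\,v \mid v\,e \mid \mathsf{case}\,v\,\mathsf{of}\,(\mathsf{in}_1 x_1\Rightarrow e_1\mid\dots\mid \mathsf{in}_n x_n\Rightarrow e_n) \mid v[\tau]$. Evaluation contexts $E ::= [\,]\mid v\,E$. Reduction $\mapsto$: $\mathsf{proj}_i\langle v_1,v_2\rangle\mapsto v_i$; $(\lambda x.e)\,v\mapsto e[v/x]$; $(\Lambda\alpha.e)[\tau]\mapsto e[\tau/\alpha]$; $\mathsf{case}\,(\mathsf{in}_j v)\,\mathsf{of}(\dots\mid\mathsf{in}_j x_j\Rightarrow e_j\mid\dots)\mapsto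 e_j[v/x_j]$; $?\mapsto\underline n$ for each $n\in\mathbb N$ (a choice reduction; $\mathsf{nat}=\mu\alpha.(\mathbf 1+\alpha)$, $\underline 0=\mathsf{in}_1\langle\rangle$, $\underline{n+1}=\mathsf{in}_2\underline n$); $v\,e\mapsto v\,e'$ if $e\mapsto e'$. Typing is the standard one for this call-by-value polymorphic lambda calculus with iso-recursive sums and $?:\mathsf{nat}$; $\mathrm{Val}(\tau)$ = closed values of closed type $\tau$. $e\overset{p}{\leadsto}e'$ means $e\mapsto^*e'$ with no choice reduction in the sequence. $\mathsf{let}\,x=e\,\mathsf{in}\,e'$ abbreviates $(\lambda x.e')\,e$. The fixed point combinator: $\mathsf{fix}=\Lambda\alpha.\Lambda\beta.\lambda f.\,\delta_f\,(\mathsf{in}\,\delta_f)$, where $\delta_f=\lambda y.\,\mathsf{case}\,y\,\mathsf{of}\,(\mathsf{in}\,y'\Rightarrow f(\lambda x.\,\mathsf{let}\,r=y'\,y\,\mathsf{in}\,r\,x))$ and $\mathsf{in}$ is the injection into the one-summand recursive type $\mu\gamma.(\gamma\to(\alpha\to\beta))$; $\mathsf{fix}:\forall\alpha.\forall\beta.((\alpha\to\beta)\to(\alpha\to\beta))\to(\alpha\to\beta)$. $\mathsf{fix}[\tau][\tau']\,f$ abbreviates $\mathsf{let}\,x=\mathsf{fix}[\tau]\,\mathsf{in}\,\mathsf{let}\,y=x[\tau']\,\mathsf{in}\,y\,f$. Observables: $e\downarrow$ if $e\mapsto^*v$ for some value $v$; $e\Downarrow$ if there is no infinite reduction sequence from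 $e$. A type-indexed relation is a set of tuples $(\Delta,\Gamma,e,e',\tau)$ with $e,e'$ both of type $\tau$ in $\Delta;\Gamma$; it is compatible if it relates each variable to itself, $\langle\rangle$ to $\langle\rangle$, $?$ to $?$, and relates terms built by the same constructor from related immediate subterms; a precongruence is a reflexive, transitive, compatible one; it is may- (must-) adequate if whenever it relates closed $e,e'$, $e\downarrow\Rightarrow e'\downarrow$ (resp. $e\Downarrow\Rightarrow e'\Downarrow$). $\lesssim^{ctx}_{\downarrow}$ ($\lesssim^{ctx}_{\Downarrow}$) is the largest may- (must-) adequate precongruence; $\cong^{ctx}_{\downarrow}$, $\cong^{ctx}_{\Downarrow}$ are their symmetrizations. -}

module Defs where

open import Data.Nat using (ℕ; zero; suc)
open import Data.Fin using (Fin; zero; suc)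
open import Data.List using (List; []; _∷_)
open import Data.Vec using (Vec; []; _∷_; lookup)
import Data.Vec as Vec
open import Data.Maybe using (Maybe; just; nothing)
open import Data.Product using (Σ; ∃; _×_; _,_)
open import Relation.Nullary using (¬_)
open import Relation.Binary.PropositionalEquality using (_≡_)
open import Relation.Binary.Construct.Closure.ReflexiveTransitive using (Star)

-- Types, with de Bruijn type variables (d = number of type variables)

data Ty (d : ℕ) : Set where
  tvar : Fin d → Ty d
  𝟙    : Ty d
  _⊗_  : Ty d → Ty d → Ty d
  _⇒_  : Ty d → Ty d → Ty d
  -- μ τ₁ [τ₂,…,τₙ] stands for μα.(τ₁ + τ₂ + … + τₙ)  (n ≥ 1 summands, α bound)
  μ    : Ty (suc d) → List (Ty (suc d)) → Ty d
  ∀'   : Ty (suc d) → Ty d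

infixr 7 _⇒_
infixr 8 _⊗_

_!!_ : {A : Set} → List A → ℕ → Maybe A
[]       !! _     = nothing
(x ∷ xs) !! zero  = just x
(x ∷ xs) !! suc i = xs !! i

sel : {A : Set} → Fin 2 → A → A → A
sel zero    a b = a
sel (suc _) a b = b

extR : {d d' : ℕ} → (Fin d → Fin d') → Fin (suc d) → Fin (suc d')
extR ρ zero    = zero
extR ρ (suc i) = suc (ρ i)

mutual
  renT : {d d' : ℕ} → (Fin d → Fin d') → Ty d → Ty d'
  renT ρ (tvar i) = tvar (ρ i)
  renT ρ 𝟙 = 𝟙
  renT ρ (a ⊗ b) = renT ρ a ⊗ renT ρ b
  renT ρ (a ⇒ b) = renT ρ a ⇒ renT ρ b
  renT ρ (μ a as) = μ (renT (extR ρ) a) (renTs (extR ρ) as)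
  renT ρ (∀' a) = ∀' (renT (extR ρ) a)

  renTs : {d d' : ℕ} → (Fin d → Fin d') → List (Ty d) → List (Ty d')
  renTs ρ [] = []
  renTs ρ (a ∷ as) = renT ρ a ∷ renTs ρ as

extS : {d d' : ℕ} → (Fin d → Ty d') → Fin (suc d) → Ty (suc d')
extS σ zero    = tvar zero
extS σ (suc i) = renT suc (σ i)

mutual
  subT : {d d' : ℕ} → (Fin d → Ty d') → Ty d → Ty d'
  subT σ (tvar i) = σ i
  subT σ 𝟙 = 𝟙
  subT σ (a ⊗ b) = subT σ a ⊗ subT σ b
  subT σ (a ⇒ b) = subT σ a ⇒ subT σ b
  subT σ (μ a as) = μ (subT (extS σ) a) (subTs (extS σ) as)
  subT σ (∀' a) = ∀' (subT (extS σ) a)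

  subTs : {d d' : ℕ} → (Fin d → Ty d') → List (Ty d) → List (Ty d')
  subTs σ [] = []
  subTs σ (a ∷ as) = subT σ a ∷ subTs σ as

single : {d : ℕ} → Ty d → Fin (suc d) → Ty d
single τ zero    = τ
single τ (suc i) = tvar i

_[_]T : {d : ℕ} → Ty (suc d) → Ty d → Ty d
τ [ σ ]T = subT (single σ) τ

-- nat = μα.(1 + α)
nat : {d : ℕ} → Ty d
nat = μ 𝟙 (tvar zero ∷ [])

-- Values and terms (d type variables, m term variables in scope)

mutual
  data Val (d m : ℕ) : Set where
    var   : Fin m → Val d m
    ⟨⟩    : Val d m
    ⟨_,_⟩ : Val d m → Val d m → Val d m
    ƛ     : Tm d (suc m) → Val d m
    inj   : ℕ → Val d m → Val d m        -- inj i = in_{i+1} (0-based index)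
    Λ     : Tm (suc d) m → Val d m

  data Tm (d m : ℕ) : Set where
    val  : Val d m → Tm d m
    ¿    : Tm d m                          -- the choice operator ?
    proj : Fin 2 → Val d m → Tm d m
    app  : Val d m → Tm d m → Tm d m
    case : Val d m → List (Tm d (suc m)) → Tm d m
    tapp : Val d m → Ty d → Tm d m

⌜_⌝ : {d m : ℕ} → ℕ → Val d m
⌜ zero ⌝  = inj 0 ⟨⟩
⌜ suc n ⌝ = inj 1 ⌜ n ⌝

mutual
  tsubV : {d d' m : ℕ} → (Fin d → Ty d') → Val d m → Val d' m
  tsubV σ (var x) = var x
  tsubV σ ⟨⟩ = ⟨⟩
  tsubV σ ⟨ v , w ⟩ = ⟨ tsubV σ v , tsubV σ w ⟩
  tsubV σ (ƛ e) = ƛ (tsubE σ e)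
  tsubV σ (inj i v) = inj i (tsubV σ v)
  tsubV σ (Λ e) = Λ (tsubE (extS σ) e)

  tsubE : {d d' m : ℕ} → (Fin d → Ty d') → Tm d m → Tm d' m
  tsubE σ (val v) = val (tsubV σ v)
  tsubE σ ¿ = ¿
  tsubE σ (proj i v) = proj i (tsubV σ v)
  tsubE σ (app v e) = app (tsubV σ v) (tsubE σ e)
  tsubE σ (case v bs) = case (tsubV σ v) (tsubEs σ bs)
  tsubE σ (tapp v τ) = tapp (tsubV σ v) (subT σ τ)

  tsubEs : {d d' m : ℕ} → (Fin d → Ty d') → List (Tm d m) → List (Tm d' m)
  tsubEs σ [] = []
  tsubEs σ (e ∷ es) = tsubE σ e ∷ tsubEs σ es

mutual
  renV : {d m m' : ℕ} → (Fin m → Fin m') → Val d m → Val d m'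
  renV ρ (var x) = var (ρ x)
  renV ρ ⟨⟩ = ⟨⟩
  renV ρ ⟨ v , w ⟩ = ⟨ renV ρ v , renV ρ w ⟩
  renV ρ (ƛ e) = ƛ (renE (extR ρ) e)
  renV ρ (inj i v) = inj i (renV ρ v)
  renV ρ (Λ e) = Λ (renE ρ e)

  renE : {d m m' : ℕ} → (Fin m → Fin m') → Tm d m → Tm d m'
  renE ρ (val v) = val (renV ρ v)
  renE ρ ¿ = ¿
  renE ρ (proj i v) = proj i (renV ρ v)
  renE ρ (app v e) = app (renV ρ v) (renE ρ e)
  renE ρ (case v bs) = case (renV ρ v) (renEs (extR ρ) bs)
  renE ρ (tapp v τ) = tapp (renV ρ v) τ

  renEs : {d m m' : ℕ} → (Fin m → Fin m') → List (Tm d m) → List (Tm d m')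
  renEs ρ [] = []
  renEs ρ (e ∷ es) = renE ρ e ∷ renEs ρ es

extV : {d m m' : ℕ} → (Fin m → Val d m') → Fin (suc m) → Val d (suc m')
extV σ zero    = var zero
extV σ (suc i) = renV suc (σ i)

tweak : {d m m' : ℕ} → (Fin m → Val d m') → Fin m → Val (suc d) m'
tweak σ i = tsubV (λ j → tvar (suc j)) (σ i)

mutual
  subV : {d m m' : ℕ} → (Fin m → Val d m') → Val d m → Val d m'
  subV σ (var x) = σ x
  subV σ ⟨⟩ = ⟨⟩
  subV σ ⟨ v , w ⟩ = ⟨ subV σ v , subV σ w ⟩
  subV σ (ƛ e) = ƛ (subE (extV σ) e)
  subV σ (inj i v) = inj i (subV σ v)
  subV σ (Λ e) = Λ (subE (tweak σ) e)

  subE : {d m m' : ℕ} → (Fin m → Val d m') → Tm d m → Tm d m'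
  subE σ (val v) = val (subV σ v)
  subE σ ¿ = ¿
  subE σ (proj i v) = proj i (subV σ v)
  subE σ (app v e) = app (subV σ v) (subE σ e)
  subE σ (case v bs) = case (subV σ v) (subEs (extV σ) bs)
  subE σ (tapp v τ) = tapp (subV σ v) τ

  subEs : {d m m' : ℕ} → (Fin m → Val d m') → List (Tm d m) → List (Tm d m')
  subEs σ [] = []
  subEs σ (e ∷ es) = subE σ e ∷ subEs σ es

singleV : {d m : ℕ} → Val d m → Fin (suc m) → Val d m
singleV v zero    = v
singleV v (suc i) = var i

_[_]v : {d m : ℕ} → Tm d (suc m) → Val d m → Tm d m
e [ v ]v = subE (singleV v) e

_[_]t : {d m : ℕ} → Tm (suc d) m → Ty d → Tm d m
e [ τ ]t = tsubE (single τ) e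

Ctx : ℕ → ℕ → Set
Ctx d m = Vec (Ty d) m

wkCtx : {d m : ℕ} → Ctx d m → Ctx (suc d) m
wkCtx Γ = Vec.map (renT suc) Γ

infix 4 _⊢v_∶_ _⊢_∶_

mutual
  data _⊢v_∶_ : {d m : ℕ} → Ctx d m → Val d m → Ty d → Set where
    ⊢var  : ∀ {d m} {Γ : Ctx d m} (x : Fin m) → Γ ⊢v var x ∶ lookup Γ x
    ⊢unit : ∀ {d m} {Γ : Ctx d m} → Γ ⊢v ⟨⟩ ∶ 𝟙
    ⊢pair : ∀ {d m} {Γ : Ctx d m} {v w a b} → Γ ⊢v v ∶ a → Γ ⊢v w ∶ b → Γ ⊢v ⟨ v , w ⟩ ∶ a ⊗ b
    ⊢ƛ    : ∀ {d m} {Γ : Ctx d m} {e a b} → (a ∷ Γ) ⊢ e ∶ b → Γ ⊢v ƛ e ∶ a ⇒ b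
    ⊢inj  : ∀ {d m} {Γ : Ctx d m} {i v a as σ} → (a ∷ as) !! i ≡ just σ →
            Γ ⊢v v ∶ (σ [ μ a as ]T) → Γ ⊢v inj i v ∶ μ a as
    ⊢Λ    : ∀ {d m} {Γ : Ctx d m} {e a} → wkCtx Γ ⊢ e ∶ a → Γ ⊢v Λ e ∶ ∀' a

  data _⊢_∶_ : {d m : ℕ} → Ctx d m → Tm d m → Ty d → Set where
    ⊢val  : ∀ {d m} {Γ : Ctx d m} {v a} → Γ ⊢v v ∶ a → Γ ⊢ val v ∶ a
    ⊢¿    : ∀ {d m} {Γ : Ctx d m} → Γ ⊢ ¿ ∶ nat
    ⊢proj : ∀ {d m} {Γ : Ctx d m} {v a b} (i : Fin 2) → Γ ⊢v v ∶ a ⊗ b → Γ ⊢ proj i v ∶ sel i a b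
    ⊢app  : ∀ {d m} {Γ : Ctx d m} {v e a b} → Γ ⊢v v ∶ a ⇒ b → Γ ⊢ e ∶ a → Γ ⊢ app v e ∶ b
    ⊢case : ∀ {d m} {Γ : Ctx d m} {v bs a as ρ} → Γ ⊢v v ∶ μ a as →
            ⊢Branches Γ (μ a as) ρ (a ∷ as) bs → Γ ⊢ case v bs ∶ ρ
    ⊢tapp : ∀ {d m} {Γ : Ctx d m} {v a} (σ : Ty d) → Γ ⊢v v ∶ ∀' a → Γ ⊢ tapp v σ ∶ (a [ σ ]T)

  data ⊢Branches : {d m : ℕ} → Ctx d m → Ty d → Ty d → List (Ty (suc d)) → List (Tm d (suc m)) → Set where
    []  : ∀ {d m} {Γ : Ctx d m} {M ρ} → ⊢Branches Γ M ρ [] []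
    _∷_ : ∀ {d m} {Γ : Ctx d m} {M ρ σ σs b bs} → ((σ [ M ]T) ∷ Γ) ⊢ b ∶ ρ →
          ⊢Branches Γ M ρ σs bs → ⊢Branches Γ M ρ (σ ∷ σs) (b ∷ bs)

data Kind : Set where
  pure choice : Kind

data _⟶[_]_ : Tm 0 0 → Kind → Tm 0 0 → Set where
  β-proj : ∀ {i v w} → proj i ⟨ v , w ⟩ ⟶[ pure ] val (sel i v w)
  β-ƛ    : ∀ {e v} → app (ƛ e) (val v) ⟶[ pure ] (e [ v ]v)
  β-Λ    : ∀ {e τ} → tapp (Λ e) τ ⟶[ pure ] (e [ τ ]t)
  β-case : ∀ {j v bs e} → bs !! j ≡ just e → case (inj j v) bs ⟶[ pure ] (e [ v ]v)
  choose : (n : ℕ) → ¿ ⟶[ choice ] val ⌜ n ⌝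
  ξ-app  : ∀ {v e e' k} → e ⟶[ k ] e' → app v e ⟶[ k ] app v e'

_⟶_ : Tm 0 0 → Tm 0 0 → Set
e ⟶ e' = Σ Kind (λ k → e ⟶[ k ] e')

_⟶*_ : Tm 0 0 → Tm 0 0 → Set
_⟶*_ = Star _⟶_

_⇝p_ : Tm 0 0 → Tm 0 0 → Set
_⇝p_ = Star (λ e e' → e ⟶[ pure ] e')

_↓ : Tm 0 0 → Set
e ↓ = Σ (Val 0 0) (λ v → e ⟶* val v)

_⇓ : Tm 0 0 → Set
e ⇓ = ¬ (Σ (ℕ → Tm 0 0) (λ s → (s 0 ≡ e) × ((n : ℕ) → s n ⟶ s (suc n))))

TRel : Set₁
TRel = ∀ {d m} → Ctx d m → Tm d m → Tm d m → Ty d → Set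

data RelBranches (R : TRel) : {d m : ℕ} → Ctx d m → Ty d → Ty d → List (Ty (suc d)) →
                   List (Tm d (suc m)) → List (Tm d (suc m)) → Set where
  []  : ∀ {d m} {Γ : Ctx d m} {M ρ} → RelBranches R Γ M ρ [] [] []
  _∷_ : ∀ {d m} {Γ : Ctx d m} {M ρ σ σs b b' bs bs'} → R ((σ [ M ]T) ∷ Γ) b b' ρ →
        RelBranches R Γ M ρ σs bs bs' → RelBranches R Γ M ρ (σ ∷ σs) (b ∷ bs) (b' ∷ bs')

record TypeIndexed (R : TRel) : Set where
  field
    typed : ∀ {d m} {Γ : Ctx d m} {e e' τ} → R Γ e e' τ → (Γ ⊢ e ∶ τ) × (Γ ⊢ e' ∶ τ)

record Compatible (R : TRel) : Set where
  field
    c-var  : ∀ {d m} {Γ : Ctx d m} (x : Fin m) → R Γ (val (var x)) (val (var x)) (lookup Γ x)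
    c-unit : ∀ {d m} {Γ : Ctx d m} → R Γ (val ⟨⟩) (val ⟨⟩) 𝟙
    c-¿    : ∀ {d m} {Γ : Ctx d m} → R Γ ¿ ¿ nat
    c-pair : ∀ {d m} {Γ : Ctx d m} {v v' w w' a b} → R Γ (val v) (val v') a → R Γ (val w) (val w') b →
             R Γ (val ⟨ v , w ⟩) (val ⟨ v' , w' ⟩) (a ⊗ b)
    c-ƛ    : ∀ {d m} {Γ : Ctx d m} {e e' a b} → R (a ∷ Γ) e e' b → R Γ (val (ƛ e)) (val (ƛ e')) (a ⇒ b)
    c-inj  : ∀ {d m} {Γ : Ctx d m} {i v v' a as σ} → (a ∷ as) !! i ≡ just σ →
             R Γ (val v) (val v') (σ [ μ a as ]T) → R Γ (val (inj i v)) (val (inj i v')) (μ a as)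
    c-Λ    : ∀ {d m} {Γ : Ctx d m} {e e' a} → R (wkCtx Γ) e e' a → R Γ (val (Λ e)) (val (Λ e')) (∀' a)
    c-proj : ∀ {d m} {Γ : Ctx d m} {v v' a b} (i : Fin 2) → R Γ (val v) (val v') (a ⊗ b) →
             R Γ (proj i v) (proj i v') (sel i a b)
    c-app  : ∀ {d m} {Γ : Ctx d m} {v v' e e' a b} → R Γ (val v) (val v') (a ⇒ b) → R Γ e e' a →
             R Γ (app v e) (app v' e') b
    c-case : ∀ {d m} {Γ : Ctx d m} {v v' bs bs' a as ρ} → R Γ (val v) (val v') (μ a as) →
             RelBranches R Γ (μ a as) ρ (a ∷ as) bs bs' → R Γ (case v bs) (case v' bs') ρ
    c-tapp : ∀ {d m} {Γ : Ctx d m} {v v' a} (σ : Ty d) → R Γ (val v) (val v') (∀' a) →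
             R Γ (tapp v σ) (tapp v' σ) (a [ σ ]T)

record Precongruence (R : TRel) : Set where
  field
    type-indexed : TypeIndexed R
    refl  : ∀ {d m} {Γ : Ctx d m} {e τ} → Γ ⊢ e ∶ τ → R Γ e e τ
    trans : ∀ {d m} {Γ : Ctx d m} {e₁ e₂ e₃ τ} → R Γ e₁ e₂ τ → R Γ e₂ e₃ τ → R Γ e₁ e₃ τ
    compatible : Compatible R

MayAdequate : TRel → Set
MayAdequate R = ∀ {e e' τ} → R [] e e' τ → e ↓ → e' ↓

MustAdequate : TRel → Set
MustAdequate R = ∀ {e e' τ} → R [] e e' τ → e ⇓ → e' ⇓

-- membership in the largest may-/must-adequate precongruence
_⊢_≲↓_∶_ : {d m : ℕ} → Ctx d m → Tm d m → Tm d m → Ty d → Set₁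
Γ ⊢ e ≲↓ e' ∶ τ = Σ TRel (λ R → Precongruence R × MayAdequate R × R Γ e e' τ)

_⊢_≲⇓_∶_ : {d m : ℕ} → Ctx d m → Tm d m → Tm d m → Ty d → Set₁
Γ ⊢ e ≲⇓ e' ∶ τ = Σ TRel (λ R → Precongruence R × MustAdequate R × R Γ e e' τ)

_⊢_≅↓_∶_ : {d m : ℕ} → Ctx d m → Tm d m → Tm d m → Ty d → Set₁
Γ ⊢ e ≅↓ e' ∶ τ = (Γ ⊢ e ≲↓ e' ∶ τ) × (Γ ⊢ e' ≲↓ e ∶ τ)

_⊢_≅⇓_∶_ : {d m : ℕ} → Ctx d m → Tm d m → Tm d m → Ty d → Set₁
Γ ⊢ e ≅⇓ e' ∶ τ = (Γ ⊢ e ≲⇓ e' ∶ τ) × (Γ ⊢ e' ≲⇓ e ∶ τ)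

-- δ_f = λy. case y of (in y' ⇒ f (λx. let r = y' y in r x)),  with f free (term var 0)
δV : Val 2 1
δV = ƛ (case (var zero)
      (app (var (suc (suc zero)))
         (val (ƛ (app (ƛ (app (var zero) (val (var (suc zero)))))
                      (app (var (suc zero)) (val (var (suc (suc zero))))))))
       ∷ []))

-- fix = Λα.Λβ.λf. δ_f (in δ_f)
fix : Val 0 0
fix = Λ (val (Λ (val (ƛ (app δV (val (inj 0 δV)))))))

weaken0 : {d m : ℕ} → Val d 0 → Val d m
weaken0 = renV (λ ())

-- fix[τ][τ'] f = let x = fix[τ] in let y = x[τ'] in y f
fix[_][_]_ : Ty 0 → Ty 0 → Val 0 0 → Tm 0 0
fix[ τ ][ τ' ] f =
  app (ƛ (app (ƛ (app (var zero) (val (weaken0 f)))) (tapp (var zero) (renT (λ ()) τ'))))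
      (tapp fix τ)

module Submission where

open import Defs
open import Data.Nat using (ℕ; zero; suc)
open import Data.Fin using (Fin; zero; suc)
open import Data.List using (List; []; _∷_)
open import Data.Vec using ([]; _∷_; lookup)
import Data.Vec as Vec
import Data.Vec.Properties as Vec
open import Data.Maybe using (just)
open import Data.Product using (Σ; _×_; _,_; proj₁; proj₂)
open import Data.Empty using (⊥-elim)
open import Relation.Nullary using (¬_)
open import Data.Sum using (_⊎_; inj₁; inj₂)
open import Relation.Binary.PropositionalEquality
  using (_≡_; refl; sym; trans; cong; cong₂; subst; subst₂; module ≡-Reasoning)
open import Relation.Binary.Construct.Closure.ReflexiveTransitive using (Star; ε; _◅_; _◅◅_)
open import Relation.Binary.Construct.Closure.Symmetric using (fwd; bwd)
open import Relation.Binary.Construct.Closure.Equivalence using (EqClosure)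
import Relation.Binary.Construct.Closure.Equivalence as EqClosure

-- We define an expansion relation L ⊒ R on open terms: the compatible closure
-- of three facts about closed terms,
--   (a) e ⊒ e'               when e ⇝p e' and e' is not a value,
--   (b) w e ⊒ w' u           when e ⇝p u (u a value) and w ⊒ w',
--   (c) λx.(λr. r x) W ⊒ W   for W a λ-abstraction.
-- Pure reduction is deterministic, so on closed terms ⊒ is a bisimulation up to pure
-- steps of the left side.  Hence ⊒ preserves and reflects may- and must-convergence,
-- and its equivalence closure ≈, restricted to typed pairs, is a may- and must-adequate
-- precongruence: ≈-related terms of equal type are contextually equivalent.  Finally
--   fix f ⇝p Ω_f = δ_f (in δ_f) ⇝p f g_f   with  g_f = λx.(λr. r x) Ω_f,
-- and f (fix f) ≈ fix f by four ⊒-steps, using that f g_f reduces to a λ-abstraction.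

-- Substitution algebra for types.  All lemmas take pointwise hypotheses on the
-- renamings/substitutions so that they can be instantiated without extensionality.

extR-∘ : ∀ {d₁ d₂ d₃} {ρ₁ : Fin d₁ → Fin d₂} {ρ₂ : Fin d₂ → Fin d₃} {ρ₃ : Fin d₁ → Fin d₃} →
  (∀ i → ρ₂ (ρ₁ i) ≡ ρ₃ i) → ∀ i → extR ρ₂ (extR ρ₁ i) ≡ extR ρ₃ i
extR-∘ h zero = refl
extR-∘ h (suc i) = cong suc (h i)

mutual
  renT-∘ : ∀ {d₁ d₂ d₃} (ρ₁ : Fin d₁ → Fin d₂) (ρ₂ : Fin d₂ → Fin d₃) (ρ₃ : Fin d₁ → Fin d₃) →
    (∀ i → ρ₂ (ρ₁ i) ≡ ρ₃ i) → ∀ a → renT ρ₂ (renT ρ₁ a) ≡ renT ρ₃ a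
  renT-∘ ρ₁ ρ₂ ρ₃ h (tvar i) = cong tvar (h i)
  renT-∘ ρ₁ ρ₂ ρ₃ h 𝟙 = refl
  renT-∘ ρ₁ ρ₂ ρ₃ h (a ⊗ b) = cong₂ _⊗_ (renT-∘ ρ₁ ρ₂ ρ₃ h a) (renT-∘ ρ₁ ρ₂ ρ₃ h b)
  renT-∘ ρ₁ ρ₂ ρ₃ h (a ⇒ b) = cong₂ _⇒_ (renT-∘ ρ₁ ρ₂ ρ₃ h a) (renT-∘ ρ₁ ρ₂ ρ₃ h b)
  renT-∘ ρ₁ ρ₂ ρ₃ h (μ a as) = cong₂ μ (renT-∘ (extR ρ₁) (extR ρ₂) (extR ρ₃) (extR-∘ h) a)
                                        (renTs-∘ (extR ρ₁) (extR ρ₂) (extR ρ₃) (extR-∘ h) as)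
  renT-∘ ρ₁ ρ₂ ρ₃ h (∀' a) = cong ∀' (renT-∘ (extR ρ₁) (extR ρ₂) (extR ρ₃) (extR-∘ h) a)

  renTs-∘ : ∀ {d₁ d₂ d₃} (ρ₁ : Fin d₁ → Fin d₂) (ρ₂ : Fin d₂ → Fin d₃) (ρ₃ : Fin d₁ → Fin d₃) →
    (∀ i → ρ₂ (ρ₁ i) ≡ ρ₃ i) → ∀ as → renTs ρ₂ (renTs ρ₁ as) ≡ renTs ρ₃ as
  renTs-∘ ρ₁ ρ₂ ρ₃ h [] = refl
  renTs-∘ ρ₁ ρ₂ ρ₃ h (a ∷ as) = cong₂ _∷_ (renT-∘ ρ₁ ρ₂ ρ₃ h a) (renTs-∘ ρ₁ ρ₂ ρ₃ h as)

extS-extR : ∀ {d₁ d₂ d₃} {ρ : Fin d₁ → Fin d₂} {σ : Fin d₂ → Ty d₃} {σ' : Fin d₁ → Ty d₃} →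
  (∀ i → σ (ρ i) ≡ σ' i) → ∀ i → extS σ (extR ρ i) ≡ extS σ' i
extS-extR h zero = refl
extS-extR h (suc i) = cong (renT suc) (h i)

mutual
  subT-renT : ∀ {d₁ d₂ d₃} (ρ : Fin d₁ → Fin d₂) (σ : Fin d₂ → Ty d₃) (σ' : Fin d₁ → Ty d₃) →
    (∀ i → σ (ρ i) ≡ σ' i) → ∀ a → subT σ (renT ρ a) ≡ subT σ' a
  subT-renT ρ σ σ' h (tvar i) = h i
  subT-renT ρ σ σ' h 𝟙 = refl
  subT-renT ρ σ σ' h (a ⊗ b) = cong₂ _⊗_ (subT-renT ρ σ σ' h a) (subT-renT ρ σ σ' h b)
  subT-renT ρ σ σ' h (a ⇒ b) = cong₂ _⇒_ (subT-renT ρ σ σ' h a) (subT-renT ρ σ σ' h b)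
  subT-renT ρ σ σ' h (μ a as) = cong₂ μ (subT-renT (extR ρ) (extS σ) (extS σ') (extS-extR h) a)
                                         (subTs-renTs (extR ρ) (extS σ) (extS σ') (extS-extR h) as)
  subT-renT ρ σ σ' h (∀' a) = cong ∀' (subT-renT (extR ρ) (extS σ) (extS σ') (extS-extR h) a)

  subTs-renTs : ∀ {d₁ d₂ d₃} (ρ : Fin d₁ → Fin d₂) (σ : Fin d₂ → Ty d₃) (σ' : Fin d₁ → Ty d₃) →
    (∀ i → σ (ρ i) ≡ σ' i) → ∀ as → subTs σ (renTs ρ as) ≡ subTs σ' as
  subTs-renTs ρ σ σ' h [] = refl
  subTs-renTs ρ σ σ' h (a ∷ as) = cong₂ _∷_ (subT-renT ρ σ σ' h a) (subTs-renTs ρ σ σ' h as)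

extR-extS : ∀ {d₁ d₂ d₃} {σ : Fin d₁ → Ty d₂} {ρ : Fin d₂ → Fin d₃} {σ' : Fin d₁ → Ty d₃} →
  (∀ i → renT ρ (σ i) ≡ σ' i) → ∀ i → renT (extR ρ) (extS σ i) ≡ extS σ' i
extR-extS h zero = refl
extR-extS {σ = σ} {ρ} h (suc i) = begin
  renT (extR ρ) (renT suc (σ i)) ≡⟨ renT-∘ suc (extR ρ) (λ j → suc (ρ j)) (λ _ → refl) (σ i) ⟩
  renT (λ j → suc (ρ j)) (σ i)   ≡⟨ sym (renT-∘ ρ suc (λ j → suc (ρ j)) (λ _ → refl) (σ i)) ⟩
  renT suc (renT ρ (σ i))        ≡⟨ cong (renT suc) (h i) ⟩
  _                              ∎
  where open ≡-Reasoning

mutual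
  renT-subT : ∀ {d₁ d₂ d₃} (σ : Fin d₁ → Ty d₂) (ρ : Fin d₂ → Fin d₃) (σ' : Fin d₁ → Ty d₃) →
    (∀ i → renT ρ (σ i) ≡ σ' i) → ∀ a → renT ρ (subT σ a) ≡ subT σ' a
  renT-subT σ ρ σ' h (tvar i) = h i
  renT-subT σ ρ σ' h 𝟙 = refl
  renT-subT σ ρ σ' h (a ⊗ b) = cong₂ _⊗_ (renT-subT σ ρ σ' h a) (renT-subT σ ρ σ' h b)
  renT-subT σ ρ σ' h (a ⇒ b) = cong₂ _⇒_ (renT-subT σ ρ σ' h a) (renT-subT σ ρ σ' h b)
  renT-subT σ ρ σ' h (μ a as) = cong₂ μ (renT-subT (extS σ) (extR ρ) (extS σ') (extR-extS h) a)
                                         (renTs-subTs (extS σ) (extR ρ) (extS σ') (extR-extS h) as)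
  renT-subT σ ρ σ' h (∀' a) = cong ∀' (renT-subT (extS σ) (extR ρ) (extS σ') (extR-extS h) a)

  renTs-subTs : ∀ {d₁ d₂ d₃} (σ : Fin d₁ → Ty d₂) (ρ : Fin d₂ → Fin d₃) (σ' : Fin d₁ → Ty d₃) →
    (∀ i → renT ρ (σ i) ≡ σ' i) → ∀ as → renTs ρ (subTs σ as) ≡ subTs σ' as
  renTs-subTs σ ρ σ' h [] = refl
  renTs-subTs σ ρ σ' h (a ∷ as) = cong₂ _∷_ (renT-subT σ ρ σ' h a) (renTs-subTs σ ρ σ' h as)

extS-∘ : ∀ {d₁ d₂ d₃} {σ₁ : Fin d₁ → Ty d₂} {σ₂ : Fin d₂ → Ty d₃} {σ₃ : Fin d₁ → Ty d₃} →
  (∀ i → subT σ₂ (σ₁ i) ≡ σ₃ i) → ∀ i → subT (extS σ₂) (extS σ₁ i) ≡ extS σ₃ i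
extS-∘ h zero = refl
extS-∘ {σ₁ = σ₁} {σ₂} h (suc i) = begin
  subT (extS σ₂) (renT suc (σ₁ i))
    ≡⟨ subT-renT suc (extS σ₂) (λ j → renT suc (σ₂ j)) (λ _ → refl) (σ₁ i) ⟩
  subT (λ j → renT suc (σ₂ j)) (σ₁ i)
    ≡⟨ sym (renT-subT σ₂ suc (λ j → renT suc (σ₂ j)) (λ _ → refl) (σ₁ i)) ⟩
  renT suc (subT σ₂ (σ₁ i))
    ≡⟨ cong (renT suc) (h i) ⟩
  _ ∎
  where open ≡-Reasoning

mutual
  subT-∘ : ∀ {d₁ d₂ d₃} (σ₁ : Fin d₁ → Ty d₂) (σ₂ : Fin d₂ → Ty d₃) (σ₃ : Fin d₁ → Ty d₃) →
    (∀ i → subT σ₂ (σ₁ i) ≡ σ₃ i) → ∀ a → subT σ₂ (subT σ₁ a) ≡ subT σ₃ a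
  subT-∘ σ₁ σ₂ σ₃ h (tvar i) = h i
  subT-∘ σ₁ σ₂ σ₃ h 𝟙 = refl
  subT-∘ σ₁ σ₂ σ₃ h (a ⊗ b) = cong₂ _⊗_ (subT-∘ σ₁ σ₂ σ₃ h a) (subT-∘ σ₁ σ₂ σ₃ h b)
  subT-∘ σ₁ σ₂ σ₃ h (a ⇒ b) = cong₂ _⇒_ (subT-∘ σ₁ σ₂ σ₃ h a) (subT-∘ σ₁ σ₂ σ₃ h b)
  subT-∘ σ₁ σ₂ σ₃ h (μ a as) = cong₂ μ (subT-∘ (extS σ₁) (extS σ₂) (extS σ₃) (extS-∘ h) a)
                                        (subTs-∘ (extS σ₁) (extS σ₂) (extS σ₃) (extS-∘ h) as)
  subT-∘ σ₁ σ₂ σ₃ h (∀' a) = cong ∀' (subT-∘ (extS σ₁) (extS σ₂) (extS σ₃) (extS-∘ h) a)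

  subTs-∘ : ∀ {d₁ d₂ d₃} (σ₁ : Fin d₁ → Ty d₂) (σ₂ : Fin d₂ → Ty d₃) (σ₃ : Fin d₁ → Ty d₃) →
    (∀ i → subT σ₂ (σ₁ i) ≡ σ₃ i) → ∀ as → subTs σ₂ (subTs σ₁ as) ≡ subTs σ₃ as
  subTs-∘ σ₁ σ₂ σ₃ h [] = refl
  subTs-∘ σ₁ σ₂ σ₃ h (a ∷ as) = cong₂ _∷_ (subT-∘ σ₁ σ₂ σ₃ h a) (subTs-∘ σ₁ σ₂ σ₃ h as)

extS-id : ∀ {d} {σ : Fin d → Ty d} → (∀ i → σ i ≡ tvar i) → ∀ i → extS σ i ≡ tvar i
extS-id h zero = refl
extS-id h (suc i) = cong (renT suc) (h i)

mutual
  subT-id : ∀ {d} (σ : Fin d → Ty d) → (∀ i → σ i ≡ tvar i) → ∀ a → subT σ a ≡ a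
  subT-id σ h (tvar i) = h i
  subT-id σ h 𝟙 = refl
  subT-id σ h (a ⊗ b) = cong₂ _⊗_ (subT-id σ h a) (subT-id σ h b)
  subT-id σ h (a ⇒ b) = cong₂ _⇒_ (subT-id σ h a) (subT-id σ h b)
  subT-id σ h (μ a as) = cong₂ μ (subT-id (extS σ) (extS-id h) a) (subTs-id (extS σ) (extS-id h) as)
  subT-id σ h (∀' a) = cong ∀' (subT-id (extS σ) (extS-id h) a)

  subTs-id : ∀ {d} (σ : Fin d → Ty d) → (∀ i → σ i ≡ tvar i) → ∀ as → subTs σ as ≡ as
  subTs-id σ h [] = refl
  subTs-id σ h (a ∷ as) = cong₂ _∷_ (subT-id σ h a) (subTs-id σ h as)

extR-id : ∀ {d} {ρ : Fin d → Fin d} → (∀ i → ρ i ≡ i) → ∀ i → extR ρ i ≡ i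
extR-id h zero = refl
extR-id h (suc i) = cong suc (h i)

mutual
  renT-id : ∀ {d} (ρ : Fin d → Fin d) → (∀ i → ρ i ≡ i) → ∀ a → renT ρ a ≡ a
  renT-id ρ h (tvar i) = cong tvar (h i)
  renT-id ρ h 𝟙 = refl
  renT-id ρ h (a ⊗ b) = cong₂ _⊗_ (renT-id ρ h a) (renT-id ρ h b)
  renT-id ρ h (a ⇒ b) = cong₂ _⇒_ (renT-id ρ h a) (renT-id ρ h b)
  renT-id ρ h (μ a as) = cong₂ μ (renT-id (extR ρ) (extR-id h) a) (renTs-id (extR ρ) (extR-id h) as)
  renT-id ρ h (∀' a) = cong ∀' (renT-id (extR ρ) (extR-id h) a)

  renTs-id : ∀ {d} (ρ : Fin d → Fin d) → (∀ i → ρ i ≡ i) → ∀ as → renTs ρ as ≡ as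
  renTs-id ρ h [] = refl
  renTs-id ρ h (a ∷ as) = cong₂ _∷_ (renT-id ρ h a) (renTs-id ρ h as)

extS-tvar : ∀ {d d'} {ρ : Fin d → Fin d'} {σ : Fin d → Ty d'} → (∀ i → σ i ≡ tvar (ρ i)) →
  ∀ i → extS σ i ≡ tvar (extR ρ i)
extS-tvar h zero = refl
extS-tvar h (suc i) = cong (renT suc) (h i)

mutual
  subT-tvar : ∀ {d d'} (ρ : Fin d → Fin d') (σ : Fin d → Ty d') → (∀ i → σ i ≡ tvar (ρ i)) →
    ∀ a → subT σ a ≡ renT ρ a
  subT-tvar ρ σ h (tvar i) = h i
  subT-tvar ρ σ h 𝟙 = refl
  subT-tvar ρ σ h (a ⊗ b) = cong₂ _⊗_ (subT-tvar ρ σ h a) (subT-tvar ρ σ h b)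
  subT-tvar ρ σ h (a ⇒ b) = cong₂ _⇒_ (subT-tvar ρ σ h a) (subT-tvar ρ σ h b)
  subT-tvar ρ σ h (μ a as) = cong₂ μ (subT-tvar (extR ρ) (extS σ) (extS-tvar h) a)
                                      (subTs-tvar (extR ρ) (extS σ) (extS-tvar h) as)
  subT-tvar ρ σ h (∀' a) = cong ∀' (subT-tvar (extR ρ) (extS σ) (extS-tvar h) a)

  subTs-tvar : ∀ {d d'} (ρ : Fin d → Fin d') (σ : Fin d → Ty d') → (∀ i → σ i ≡ tvar (ρ i)) →
    ∀ as → subTs σ as ≡ renTs ρ as
  subTs-tvar ρ σ h [] = refl
  subTs-tvar ρ σ h (a ∷ as) = cong₂ _∷_ (subT-tvar ρ σ h a) (subTs-tvar ρ σ h as)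

wk-single : ∀ {d} (a b : Ty d) → (renT suc a) [ b ]T ≡ a
wk-single a b = trans (subT-renT suc (single b) tvar (λ _ → refl) a) (subT-id tvar (λ _ → refl) a)

subT-single : ∀ {d d'} (σ : Fin d → Ty d') (a : Ty (suc d)) (b : Ty d) →
  subT σ (a [ b ]T) ≡ (subT (extS σ) a) [ subT σ b ]T
subT-single σ a b =
  trans (subT-∘ (single b) σ (λ i → subT σ (single b i)) (λ _ → refl) a)
        (sym (subT-∘ (extS σ) (single (subT σ b)) (λ i → subT σ (single b i)) instantiate a))
  where
  instantiate : ∀ i → subT (single (subT σ b)) (extS σ i) ≡ subT σ (single b i)
  instantiate zero = refl
  instantiate (suc i) = wk-single (σ i) (subT σ b)

subT-wk : ∀ {d d'} (σ : Fin d → Ty d') (a : Ty d) → subT (extS σ) (renT suc a) ≡ renT suc (subT σ a)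
subT-wk σ a = trans (subT-renT suc (extS σ) (λ j → renT suc (σ j)) (λ _ → refl) a)
                    (sym (renT-subT σ suc (λ j → renT suc (σ j)) (λ _ → refl) a))

mutual
  renV-∘ : ∀ {d m₁ m₂ m₃} (ρ₁ : Fin m₁ → Fin m₂) (ρ₂ : Fin m₂ → Fin m₃) (ρ₃ : Fin m₁ → Fin m₃) →
    (∀ i → ρ₂ (ρ₁ i) ≡ ρ₃ i) → (v : Val d m₁) → renV ρ₂ (renV ρ₁ v) ≡ renV ρ₃ v
  renV-∘ ρ₁ ρ₂ ρ₃ h (var x) = cong var (h x)
  renV-∘ ρ₁ ρ₂ ρ₃ h ⟨⟩ = refl
  renV-∘ ρ₁ ρ₂ ρ₃ h ⟨ v , w ⟩ = cong₂ ⟨_,_⟩ (renV-∘ ρ₁ ρ₂ ρ₃ h v) (renV-∘ ρ₁ ρ₂ ρ₃ h w)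
  renV-∘ ρ₁ ρ₂ ρ₃ h (ƛ e) = cong ƛ (renE-∘ (extR ρ₁) (extR ρ₂) (extR ρ₃) (extR-∘ h) e)
  renV-∘ ρ₁ ρ₂ ρ₃ h (inj i v) = cong (inj i) (renV-∘ ρ₁ ρ₂ ρ₃ h v)
  renV-∘ ρ₁ ρ₂ ρ₃ h (Λ e) = cong Λ (renE-∘ ρ₁ ρ₂ ρ₃ h e)

  renE-∘ : ∀ {d m₁ m₂ m₃} (ρ₁ : Fin m₁ → Fin m₂) (ρ₂ : Fin m₂ → Fin m₃) (ρ₃ : Fin m₁ → Fin m₃) →
    (∀ i → ρ₂ (ρ₁ i) ≡ ρ₃ i) → (e : Tm d m₁) → renE ρ₂ (renE ρ₁ e) ≡ renE ρ₃ e
  renE-∘ ρ₁ ρ₂ ρ₃ h (val v) = cong val (renV-∘ ρ₁ ρ₂ ρ₃ h v)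
  renE-∘ ρ₁ ρ₂ ρ₃ h ¿ = refl
  renE-∘ ρ₁ ρ₂ ρ₃ h (proj i v) = cong (proj i) (renV-∘ ρ₁ ρ₂ ρ₃ h v)
  renE-∘ ρ₁ ρ₂ ρ₃ h (app v e) = cong₂ app (renV-∘ ρ₁ ρ₂ ρ₃ h v) (renE-∘ ρ₁ ρ₂ ρ₃ h e)
  renE-∘ ρ₁ ρ₂ ρ₃ h (case v bs) =
    cong₂ case (renV-∘ ρ₁ ρ₂ ρ₃ h v) (renEs-∘ (extR ρ₁) (extR ρ₂) (extR ρ₃) (extR-∘ h) bs)
  renE-∘ ρ₁ ρ₂ ρ₃ h (tapp v τ) = cong (λ x → tapp x τ) (renV-∘ ρ₁ ρ₂ ρ₃ h v)

  renEs-∘ : ∀ {d m₁ m₂ m₃} (ρ₁ : Fin m₁ → Fin m₂) (ρ₂ : Fin m₂ → Fin m₃) (ρ₃ : Fin m₁ → Fin m₃) →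
    (∀ i → ρ₂ (ρ₁ i) ≡ ρ₃ i) → (es : List (Tm d m₁)) → renEs ρ₂ (renEs ρ₁ es) ≡ renEs ρ₃ es
  renEs-∘ ρ₁ ρ₂ ρ₃ h [] = refl
  renEs-∘ ρ₁ ρ₂ ρ₃ h (e ∷ es) = cong₂ _∷_ (renE-∘ ρ₁ ρ₂ ρ₃ h e) (renEs-∘ ρ₁ ρ₂ ρ₃ h es)

mutual
  renV-id : ∀ {d m} (ρ : Fin m → Fin m) → (∀ i → ρ i ≡ i) → (v : Val d m) → renV ρ v ≡ v
  renV-id ρ h (var x) = cong var (h x)
  renV-id ρ h ⟨⟩ = refl
  renV-id ρ h ⟨ v , w ⟩ = cong₂ ⟨_,_⟩ (renV-id ρ h v) (renV-id ρ h w)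
  renV-id ρ h (ƛ e) = cong ƛ (renE-id (extR ρ) (extR-id h) e)
  renV-id ρ h (inj i v) = cong (inj i) (renV-id ρ h v)
  renV-id ρ h (Λ e) = cong Λ (renE-id ρ h e)

  renE-id : ∀ {d m} (ρ : Fin m → Fin m) → (∀ i → ρ i ≡ i) → (e : Tm d m) → renE ρ e ≡ e
  renE-id ρ h (val v) = cong val (renV-id ρ h v)
  renE-id ρ h ¿ = refl
  renE-id ρ h (proj i v) = cong (proj i) (renV-id ρ h v)
  renE-id ρ h (app v e) = cong₂ app (renV-id ρ h v) (renE-id ρ h e)
  renE-id ρ h (case v bs) = cong₂ case (renV-id ρ h v) (renEs-id (extR ρ) (extR-id h) bs)
  renE-id ρ h (tapp v τ) = cong (λ x → tapp x τ) (renV-id ρ h v)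

  renEs-id : ∀ {d m} (ρ : Fin m → Fin m) → (∀ i → ρ i ≡ i) → (es : List (Tm d m)) → renEs ρ es ≡ es
  renEs-id ρ h [] = refl
  renEs-id ρ h (e ∷ es) = cong₂ _∷_ (renE-id ρ h e) (renEs-id ρ h es)

extV-extR : ∀ {d m₁ m₂ m₃} {ρ : Fin m₁ → Fin m₂} {σ : Fin m₂ → Val d m₃} {σ' : Fin m₁ → Val d m₃} →
  (∀ i → σ (ρ i) ≡ σ' i) → ∀ i → extV σ (extR ρ i) ≡ extV σ' i
extV-extR h zero = refl
extV-extR h (suc i) = cong (renV suc) (h i)

mutual
  subV-renV : ∀ {d m₁ m₂ m₃} (ρ : Fin m₁ → Fin m₂) (σ : Fin m₂ → Val d m₃) (σ' : Fin m₁ → Val d m₃) →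
    (∀ i → σ (ρ i) ≡ σ' i) → (v : Val d m₁) → subV σ (renV ρ v) ≡ subV σ' v
  subV-renV ρ σ σ' h (var x) = h x
  subV-renV ρ σ σ' h ⟨⟩ = refl
  subV-renV ρ σ σ' h ⟨ v , w ⟩ = cong₂ ⟨_,_⟩ (subV-renV ρ σ σ' h v) (subV-renV ρ σ σ' h w)
  subV-renV ρ σ σ' h (ƛ e) = cong ƛ (subE-renE (extR ρ) (extV σ) (extV σ') (extV-extR h) e)
  subV-renV ρ σ σ' h (inj i v) = cong (inj i) (subV-renV ρ σ σ' h v)
  subV-renV ρ σ σ' h (Λ e) =
    cong Λ (subE-renE ρ (tweak σ) (tweak σ') (λ i → cong (tsubV (λ j → tvar (suc j))) (h i)) e)

  subE-renE : ∀ {d m₁ m₂ m₃} (ρ : Fin m₁ → Fin m₂) (σ : Fin m₂ → Val d m₃) (σ' : Fin m₁ → Val d m₃) →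
    (∀ i → σ (ρ i) ≡ σ' i) → (e : Tm d m₁) → subE σ (renE ρ e) ≡ subE σ' e
  subE-renE ρ σ σ' h (val v) = cong val (subV-renV ρ σ σ' h v)
  subE-renE ρ σ σ' h ¿ = refl
  subE-renE ρ σ σ' h (proj i v) = cong (proj i) (subV-renV ρ σ σ' h v)
  subE-renE ρ σ σ' h (app v e) = cong₂ app (subV-renV ρ σ σ' h v) (subE-renE ρ σ σ' h e)
  subE-renE ρ σ σ' h (case v bs) =
    cong₂ case (subV-renV ρ σ σ' h v) (subEs-renEs (extR ρ) (extV σ) (extV σ') (extV-extR h) bs)
  subE-renE ρ σ σ' h (tapp v τ) = cong (λ x → tapp x τ) (subV-renV ρ σ σ' h v)

  subEs-renEs : ∀ {d m₁ m₂ m₃} (ρ : Fin m₁ → Fin m₂) (σ : Fin m₂ → Val d m₃) (σ' : Fin m₁ → Val d m₃) →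
    (∀ i → σ (ρ i) ≡ σ' i) → (es : List (Tm d m₁)) → subEs σ (renEs ρ es) ≡ subEs σ' es
  subEs-renEs ρ σ σ' h [] = refl
  subEs-renEs ρ σ σ' h (e ∷ es) = cong₂ _∷_ (subE-renE ρ σ σ' h e) (subEs-renEs ρ σ σ' h es)

extV-var : ∀ {d m} {σ : Fin m → Val d m} → (∀ i → σ i ≡ var i) → ∀ i → extV σ i ≡ var i
extV-var h zero = refl
extV-var h (suc i) = cong (renV suc) (h i)

mutual
  subV-id : ∀ {d m} (σ : Fin m → Val d m) → (∀ i → σ i ≡ var i) → (v : Val d m) → subV σ v ≡ v
  subV-id σ h (var x) = h x
  subV-id σ h ⟨⟩ = refl
  subV-id σ h ⟨ v , w ⟩ = cong₂ ⟨_,_⟩ (subV-id σ h v) (subV-id σ h w)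
  subV-id σ h (ƛ e) = cong ƛ (subE-id (extV σ) (extV-var h) e)
  subV-id σ h (inj i v) = cong (inj i) (subV-id σ h v)
  subV-id σ h (Λ e) = cong Λ (subE-id (tweak σ) (λ i → cong (tsubV (λ j → tvar (suc j))) (h i)) e)

  subE-id : ∀ {d m} (σ : Fin m → Val d m) → (∀ i → σ i ≡ var i) → (e : Tm d m) → subE σ e ≡ e
  subE-id σ h (val v) = cong val (subV-id σ h v)
  subE-id σ h ¿ = refl
  subE-id σ h (proj i v) = cong (proj i) (subV-id σ h v)
  subE-id σ h (app v e) = cong₂ app (subV-id σ h v) (subE-id σ h e)
  subE-id σ h (case v bs) = cong₂ case (subV-id σ h v) (subEs-id (extV σ) (extV-var h) bs)
  subE-id σ h (tapp v τ) = cong (λ x → tapp x τ) (subV-id σ h v)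

  subEs-id : ∀ {d m} (σ : Fin m → Val d m) → (∀ i → σ i ≡ var i) → (es : List (Tm d m)) → subEs σ es ≡ es
  subEs-id σ h [] = refl
  subEs-id σ h (e ∷ es) = cong₂ _∷_ (subE-id σ h e) (subEs-id σ h es)

mutual
  tsubV-renV : ∀ {d d' m m'} (θ : Fin d → Ty d') (ρ : Fin m → Fin m') (v : Val d m) →
    tsubV θ (renV ρ v) ≡ renV ρ (tsubV θ v)
  tsubV-renV θ ρ (var x) = refl
  tsubV-renV θ ρ ⟨⟩ = refl
  tsubV-renV θ ρ ⟨ v , w ⟩ = cong₂ ⟨_,_⟩ (tsubV-renV θ ρ v) (tsubV-renV θ ρ w)
  tsubV-renV θ ρ (ƛ e) = cong ƛ (tsubE-renE θ (extR ρ) e)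
  tsubV-renV θ ρ (inj i v) = cong (inj i) (tsubV-renV θ ρ v)
  tsubV-renV θ ρ (Λ e) = cong Λ (tsubE-renE (extS θ) ρ e)

  tsubE-renE : ∀ {d d' m m'} (θ : Fin d → Ty d') (ρ : Fin m → Fin m') (e : Tm d m) →
    tsubE θ (renE ρ e) ≡ renE ρ (tsubE θ e)
  tsubE-renE θ ρ (val v) = cong val (tsubV-renV θ ρ v)
  tsubE-renE θ ρ ¿ = refl
  tsubE-renE θ ρ (proj i v) = cong (proj i) (tsubV-renV θ ρ v)
  tsubE-renE θ ρ (app v e) = cong₂ app (tsubV-renV θ ρ v) (tsubE-renE θ ρ e)
  tsubE-renE θ ρ (case v bs) = cong₂ case (tsubV-renV θ ρ v) (tsubEs-renEs θ (extR ρ) bs)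
  tsubE-renE θ ρ (tapp v τ) = cong (λ x → tapp x (subT θ τ)) (tsubV-renV θ ρ v)

  tsubEs-renEs : ∀ {d d' m m'} (θ : Fin d → Ty d') (ρ : Fin m → Fin m') (es : List (Tm d m)) →
    tsubEs θ (renEs ρ es) ≡ renEs ρ (tsubEs θ es)
  tsubEs-renEs θ ρ [] = refl
  tsubEs-renEs θ ρ (e ∷ es) = cong₂ _∷_ (tsubE-renE θ ρ e) (tsubEs-renEs θ ρ es)

mutual
  tsubV-∘ : ∀ {d₁ d₂ d₃ m} (θ₁ : Fin d₁ → Ty d₂) (θ₂ : Fin d₂ → Ty d₃) (θ₃ : Fin d₁ → Ty d₃) →
    (∀ i → subT θ₂ (θ₁ i) ≡ θ₃ i) → (v : Val d₁ m) → tsubV θ₂ (tsubV θ₁ v) ≡ tsubV θ₃ v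
  tsubV-∘ θ₁ θ₂ θ₃ h (var x) = refl
  tsubV-∘ θ₁ θ₂ θ₃ h ⟨⟩ = refl
  tsubV-∘ θ₁ θ₂ θ₃ h ⟨ v , w ⟩ = cong₂ ⟨_,_⟩ (tsubV-∘ θ₁ θ₂ θ₃ h v) (tsubV-∘ θ₁ θ₂ θ₃ h w)
  tsubV-∘ θ₁ θ₂ θ₃ h (ƛ e) = cong ƛ (tsubE-∘ θ₁ θ₂ θ₃ h e)
  tsubV-∘ θ₁ θ₂ θ₃ h (inj i v) = cong (inj i) (tsubV-∘ θ₁ θ₂ θ₃ h v)
  tsubV-∘ θ₁ θ₂ θ₃ h (Λ e) = cong Λ (tsubE-∘ (extS θ₁) (extS θ₂) (extS θ₃) (extS-∘ h) e)

  tsubE-∘ : ∀ {d₁ d₂ d₃ m} (θ₁ : Fin d₁ → Ty d₂) (θ₂ : Fin d₂ → Ty d₃) (θ₃ : Fin d₁ → Ty d₃) →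
    (∀ i → subT θ₂ (θ₁ i) ≡ θ₃ i) → (e : Tm d₁ m) → tsubE θ₂ (tsubE θ₁ e) ≡ tsubE θ₃ e
  tsubE-∘ θ₁ θ₂ θ₃ h (val v) = cong val (tsubV-∘ θ₁ θ₂ θ₃ h v)
  tsubE-∘ θ₁ θ₂ θ₃ h ¿ = refl
  tsubE-∘ θ₁ θ₂ θ₃ h (proj i v) = cong (proj i) (tsubV-∘ θ₁ θ₂ θ₃ h v)
  tsubE-∘ θ₁ θ₂ θ₃ h (app v e) = cong₂ app (tsubV-∘ θ₁ θ₂ θ₃ h v) (tsubE-∘ θ₁ θ₂ θ₃ h e)
  tsubE-∘ θ₁ θ₂ θ₃ h (case v bs) = cong₂ case (tsubV-∘ θ₁ θ₂ θ₃ h v) (tsubEs-∘ θ₁ θ₂ θ₃ h bs)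
  tsubE-∘ θ₁ θ₂ θ₃ h (tapp v τ) = cong₂ tapp (tsubV-∘ θ₁ θ₂ θ₃ h v) (subT-∘ θ₁ θ₂ θ₃ h τ)

  tsubEs-∘ : ∀ {d₁ d₂ d₃ m} (θ₁ : Fin d₁ → Ty d₂) (θ₂ : Fin d₂ → Ty d₃) (θ₃ : Fin d₁ → Ty d₃) →
    (∀ i → subT θ₂ (θ₁ i) ≡ θ₃ i) → (es : List (Tm d₁ m)) → tsubEs θ₂ (tsubEs θ₁ es) ≡ tsubEs θ₃ es
  tsubEs-∘ θ₁ θ₂ θ₃ h [] = refl
  tsubEs-∘ θ₁ θ₂ θ₃ h (e ∷ es) = cong₂ _∷_ (tsubE-∘ θ₁ θ₂ θ₃ h e) (tsubEs-∘ θ₁ θ₂ θ₃ h es)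

mutual
  tsubV-id : ∀ {d m} (θ : Fin d → Ty d) → (∀ i → θ i ≡ tvar i) → (v : Val d m) → tsubV θ v ≡ v
  tsubV-id θ h (var x) = refl
  tsubV-id θ h ⟨⟩ = refl
  tsubV-id θ h ⟨ v , w ⟩ = cong₂ ⟨_,_⟩ (tsubV-id θ h v) (tsubV-id θ h w)
  tsubV-id θ h (ƛ e) = cong ƛ (tsubE-id θ h e)
  tsubV-id θ h (inj i v) = cong (inj i) (tsubV-id θ h v)
  tsubV-id θ h (Λ e) = cong Λ (tsubE-id (extS θ) (extS-id h) e)

  tsubE-id : ∀ {d m} (θ : Fin d → Ty d) → (∀ i → θ i ≡ tvar i) → (e : Tm d m) → tsubE θ e ≡ e
  tsubE-id θ h (val v) = cong val (tsubV-id θ h v)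
  tsubE-id θ h ¿ = refl
  tsubE-id θ h (proj i v) = cong (proj i) (tsubV-id θ h v)
  tsubE-id θ h (app v e) = cong₂ app (tsubV-id θ h v) (tsubE-id θ h e)
  tsubE-id θ h (case v bs) = cong₂ case (tsubV-id θ h v) (tsubEs-id θ h bs)
  tsubE-id θ h (tapp v τ) = cong₂ tapp (tsubV-id θ h v) (subT-id θ h τ)

  tsubEs-id : ∀ {d m} (θ : Fin d → Ty d) → (∀ i → θ i ≡ tvar i) → (es : List (Tm d m)) → tsubEs θ es ≡ es
  tsubEs-id θ h [] = refl
  tsubEs-id θ h (e ∷ es) = cong₂ _∷_ (tsubE-id θ h e) (tsubEs-id θ h es)

-- Embedded closed terms are invariant under
-- every renaming and substitution; this is what lets the expansion relation below refer
-- to closed terms at every scope and remain stable under substitution.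

emb : ∀ {d m} → Tm 0 0 → Tm d m
emb e = renE (λ ()) (tsubE (λ ()) e)

embV : ∀ {d m} → Val 0 0 → Val d m
embV v = renV (λ ()) (tsubV (λ ()) v)

emb-closed : (e : Tm 0 0) → emb e ≡ e
emb-closed e = trans (renE-id (λ ()) (λ ()) _) (tsubE-id (λ ()) (λ ()) e)

embV-closed : (v : Val 0 0) → embV v ≡ v
embV-closed v = trans (renV-id (λ ()) (λ ()) _) (tsubV-id (λ ()) (λ ()) v)

renE-emb : ∀ {d m m'} (ρ : Fin m → Fin m') (e : Tm 0 0) → renE ρ (emb {d} e) ≡ emb e
renE-emb ρ e = renE-∘ (λ ()) ρ (λ ()) (λ ()) _

renV-embV : ∀ {d m m'} (ρ : Fin m → Fin m') (v : Val 0 0) → renV ρ (embV {d} v) ≡ embV v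
renV-embV ρ v = renV-∘ (λ ()) ρ (λ ()) (λ ()) _

subE-emb : ∀ {d m m'} (σ : Fin m → Val d m') (e : Tm 0 0) → subE σ (emb e) ≡ emb e
subE-emb σ e = begin
  subE σ (renE (λ ()) t)   ≡⟨ subE-renE (λ ()) σ (λ ()) (λ ()) t ⟩
  subE (λ ()) t            ≡⟨ sym (subE-renE (λ ()) var (λ ()) (λ ()) t) ⟩
  subE var (renE (λ ()) t) ≡⟨ subE-id var (λ _ → refl) (renE (λ ()) t) ⟩
  renE (λ ()) t            ∎
  where
  open ≡-Reasoning
  t = tsubE (λ ()) e

subV-embV : ∀ {d m m'} (σ : Fin m → Val d m') (v : Val 0 0) → subV σ (embV v) ≡ embV v
subV-embV σ v = begin
  subV σ (renV (λ ()) t)   ≡⟨ subV-renV (λ ()) σ (λ ()) (λ ()) t ⟩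
  subV (λ ()) t            ≡⟨ sym (subV-renV (λ ()) var (λ ()) (λ ()) t) ⟩
  subV var (renV (λ ()) t) ≡⟨ subV-id var (λ _ → refl) (renV (λ ()) t) ⟩
  renV (λ ()) t            ∎
  where
  open ≡-Reasoning
  t = tsubV (λ ()) v

tsubE-emb : ∀ {d d' m} (θ : Fin d → Ty d') (e : Tm 0 0) → tsubE θ (emb {d} {m} e) ≡ emb e
tsubE-emb θ e = trans (tsubE-renE θ (λ ()) _) (cong (renE (λ ())) (tsubE-∘ (λ ()) θ (λ ()) (λ ()) e))

tsubV-embV : ∀ {d d' m} (θ : Fin d → Ty d') (v : Val 0 0) → tsubV θ (embV {d} {m} v) ≡ embV v
tsubV-embV θ v = trans (tsubV-renV θ (λ ()) _) (cong (renV (λ ())) (tsubV-∘ (λ ()) θ (λ ()) (λ ()) v))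

weaken0-embV : ∀ {m} (v : Val 0 0) → weaken0 {0} {m} v ≡ embV v
weaken0-embV v = cong (renV (λ ())) (sym (tsubV-id (λ ()) (λ ()) v))

lookup-extR : ∀ {d m m'} {Γ : Ctx d m} {Δ : Ctx d m'} {ρ : Fin m → Fin m'} (a : Ty d) →
  (∀ x → lookup Δ (ρ x) ≡ lookup Γ x) → ∀ x → lookup (a ∷ Δ) (extR ρ x) ≡ lookup (a ∷ Γ) x
lookup-extR a h zero = refl
lookup-extR a h (suc x) = h x

lookup-wkCtx : ∀ {d m m'} {Γ : Ctx d m} {Δ : Ctx d m'} {ρ : Fin m → Fin m'} →
  (∀ x → lookup Δ (ρ x) ≡ lookup Γ x) → ∀ x → lookup (wkCtx Δ) (ρ x) ≡ lookup (wkCtx Γ) x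
lookup-wkCtx {Γ = Γ} {Δ} {ρ} h x = trans (Vec.lookup-map (ρ x) (renT suc) Δ)
  (trans (cong (renT suc) (h x)) (sym (Vec.lookup-map x (renT suc) Γ)))

mutual
  ren⊢v : ∀ {d m m'} {Γ : Ctx d m} {Δ : Ctx d m'} (ρ : Fin m → Fin m') →
    (∀ x → lookup Δ (ρ x) ≡ lookup Γ x) → ∀ {v a} → Γ ⊢v v ∶ a → Δ ⊢v renV ρ v ∶ a
  ren⊢v {Δ = Δ} ρ h (⊢var x) = subst (λ t → Δ ⊢v var (ρ x) ∶ t) (h x) (⊢var (ρ x))
  ren⊢v ρ h ⊢unit = ⊢unit
  ren⊢v ρ h (⊢pair p q) = ⊢pair (ren⊢v ρ h p) (ren⊢v ρ h q)
  ren⊢v ρ h (⊢ƛ {a = a} p) = ⊢ƛ (ren⊢ (extR ρ) (lookup-extR a h) p)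
  ren⊢v ρ h (⊢inj eq p) = ⊢inj eq (ren⊢v ρ h p)
  ren⊢v {Γ = Γ} {Δ} ρ h (⊢Λ p) = ⊢Λ (ren⊢ ρ (lookup-wkCtx {Γ = Γ} {Δ} {ρ} h) p)

  ren⊢ : ∀ {d m m'} {Γ : Ctx d m} {Δ : Ctx d m'} (ρ : Fin m → Fin m') →
    (∀ x → lookup Δ (ρ x) ≡ lookup Γ x) → ∀ {e a} → Γ ⊢ e ∶ a → Δ ⊢ renE ρ e ∶ a
  ren⊢ ρ h (⊢val p) = ⊢val (ren⊢v ρ h p)
  ren⊢ ρ h ⊢¿ = ⊢¿
  ren⊢ ρ h (⊢proj i p) = ⊢proj i (ren⊢v ρ h p)
  ren⊢ ρ h (⊢app p q) = ⊢app (ren⊢v ρ h p) (ren⊢ ρ h q)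
  ren⊢ ρ h (⊢case p bs) = ⊢case (ren⊢v ρ h p) (ren⊢Bs ρ h bs)
  ren⊢ ρ h (⊢tapp σ p) = ⊢tapp σ (ren⊢v ρ h p)

  ren⊢Bs : ∀ {d m m'} {Γ : Ctx d m} {Δ : Ctx d m'} (ρ : Fin m → Fin m') →
    (∀ x → lookup Δ (ρ x) ≡ lookup Γ x) → ∀ {M r σs bs} →
    ⊢Branches Γ M r σs bs → ⊢Branches Δ M r σs (renEs (extR ρ) bs)
  ren⊢Bs ρ h [] = []
  ren⊢Bs ρ h {M} (_∷_ {σ = σ} p ps) = ren⊢ (extR ρ) (lookup-extR (σ [ M ]T) h) p ∷ ren⊢Bs ρ h ps

closed⊢v : ∀ {m} {Γ : Ctx 0 m} {v a} → [] ⊢v v ∶ a → Γ ⊢v renV (λ ()) v ∶ a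
closed⊢v p = ren⊢v (λ ()) (λ ()) p

closed⊢ : ∀ {m} {Γ : Ctx 0 m} {e a} → [] ⊢ e ∶ a → Γ ⊢ renE (λ ()) e ∶ a
closed⊢ p = ren⊢ (λ ()) (λ ()) p

!!-subTs : ∀ {d d'} (θ : Fin d → Ty d') (as : List (Ty d)) (i : ℕ) {σ} → as !! i ≡ just σ →
  subTs θ as !! i ≡ just (subT θ σ)
!!-subTs θ [] i ()
!!-subTs θ (a ∷ as) zero refl = refl
!!-subTs θ (a ∷ as) (suc i) eq = !!-subTs θ as i eq

subT-sel : ∀ {d d'} (θ : Fin d → Ty d') (i : Fin 2) (a b : Ty d) →
  subT θ (sel i a b) ≡ sel i (subT θ a) (subT θ b)
subT-sel θ zero a b = refl
subT-sel θ (suc i) a b = refl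

subT-wkCtx : ∀ {d d' m} (θ : Fin d → Ty d') (Γ : Ctx d m) →
  Vec.map (subT (extS θ)) (wkCtx Γ) ≡ wkCtx (Vec.map (subT θ) Γ)
subT-wkCtx θ [] = refl
subT-wkCtx θ (a ∷ Γ) = cong₂ _∷_ (subT-wk θ a) (subT-wkCtx θ Γ)

mutual
  tsub⊢v : ∀ {d d' m} {Γ : Ctx d m} (θ : Fin d → Ty d') → ∀ {v a} →
    Γ ⊢v v ∶ a → Vec.map (subT θ) Γ ⊢v tsubV θ v ∶ subT θ a
  tsub⊢v {Γ = Γ} θ (⊢var x) =
    subst (λ t → Vec.map (subT θ) Γ ⊢v var x ∶ t) (Vec.lookup-map x (subT θ) Γ) (⊢var x)
  tsub⊢v θ ⊢unit = ⊢unit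
  tsub⊢v θ (⊢pair p q) = ⊢pair (tsub⊢v θ p) (tsub⊢v θ q)
  tsub⊢v θ (⊢ƛ p) = ⊢ƛ (tsub⊢ θ p)
  tsub⊢v {Γ = Γ} θ (⊢inj {i = i} {v} {a} {as} {σ} eq p) =
    ⊢inj (!!-subTs (extS θ) (a ∷ as) i eq)
         (subst (λ t → Vec.map (subT θ) Γ ⊢v tsubV θ v ∶ t) (subT-single θ σ (μ a as)) (tsub⊢v θ p))
  tsub⊢v {Γ = Γ} θ (⊢Λ {e = e} {a} p) =
    ⊢Λ (subst (λ G → G ⊢ tsubE (extS θ) e ∶ subT (extS θ) a) (subT-wkCtx θ Γ) (tsub⊢ (extS θ) p))

  tsub⊢ : ∀ {d d' m} {Γ : Ctx d m} (θ : Fin d → Ty d') → ∀ {e a} →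
    Γ ⊢ e ∶ a → Vec.map (subT θ) Γ ⊢ tsubE θ e ∶ subT θ a
  tsub⊢ θ (⊢val p) = ⊢val (tsub⊢v θ p)
  tsub⊢ θ ⊢¿ = ⊢¿
  tsub⊢ {Γ = Γ} θ (⊢proj {v = v} {a} {b} i p) =
    subst (λ t → Vec.map (subT θ) Γ ⊢ proj i (tsubV θ v) ∶ t) (sym (subT-sel θ i a b)) (⊢proj i (tsub⊢v θ p))
  tsub⊢ θ (⊢app p q) = ⊢app (tsub⊢v θ p) (tsub⊢ θ q)
  tsub⊢ θ (⊢case p bs) = ⊢case (tsub⊢v θ p) (tsub⊢Bs θ bs)
  tsub⊢ {Γ = Γ} θ (⊢tapp {v = v} {a} σ p) =
    subst (λ t → Vec.map (subT θ) Γ ⊢ tapp (tsubV θ v) (subT θ σ) ∶ t) (sym (subT-single θ a σ))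
          (⊢tapp (subT θ σ) (tsub⊢v θ p))

  tsub⊢Bs : ∀ {d d' m} {Γ : Ctx d m} (θ : Fin d → Ty d') → ∀ {M r σs bs} → ⊢Branches Γ M r σs bs →
    ⊢Branches (Vec.map (subT θ) Γ) (subT θ M) (subT θ r) (subTs (extS θ) σs) (tsubEs θ bs)
  tsub⊢Bs θ [] = []
  tsub⊢Bs {Γ = Γ} θ {M} {r} (_∷_ {σ = σ} {b = b} p ps) =
    subst (λ t → (t ∷ Vec.map (subT θ) Γ) ⊢ tsubE θ b ∶ subT θ r) (subT-single θ σ M) (tsub⊢ θ p)
    ∷ tsub⊢Bs θ ps

mutual
  sub⊢v : ∀ {d m m'} {Γ : Ctx d m} {Δ : Ctx d m'} (σ : Fin m → Val d m') →
    (∀ x → Δ ⊢v σ x ∶ lookup Γ x) → ∀ {v a} → Γ ⊢v v ∶ a → Δ ⊢v subV σ v ∶ a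
  sub⊢v σ h (⊢var x) = h x
  sub⊢v σ h ⊢unit = ⊢unit
  sub⊢v σ h (⊢pair p q) = ⊢pair (sub⊢v σ h p) (sub⊢v σ h q)
  sub⊢v σ h (⊢ƛ {a = a} p) = ⊢ƛ (sub⊢ (extV σ) (⊢extV a σ h) p)
  sub⊢v σ h (⊢inj eq p) = ⊢inj eq (sub⊢v σ h p)
  sub⊢v {Γ = Γ} {Δ} σ h (⊢Λ p) = ⊢Λ (sub⊢ (tweak σ) (⊢tweak {Γ = Γ} {Δ} σ h) p)

  sub⊢ : ∀ {d m m'} {Γ : Ctx d m} {Δ : Ctx d m'} (σ : Fin m → Val d m') →
    (∀ x → Δ ⊢v σ x ∶ lookup Γ x) → ∀ {e a} → Γ ⊢ e ∶ a → Δ ⊢ subE σ e ∶ a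
  sub⊢ σ h (⊢val p) = ⊢val (sub⊢v σ h p)
  sub⊢ σ h ⊢¿ = ⊢¿
  sub⊢ σ h (⊢proj i p) = ⊢proj i (sub⊢v σ h p)
  sub⊢ σ h (⊢app p q) = ⊢app (sub⊢v σ h p) (sub⊢ σ h q)
  sub⊢ σ h (⊢case p bs) = ⊢case (sub⊢v σ h p) (sub⊢Bs σ h bs)
  sub⊢ σ h (⊢tapp τ p) = ⊢tapp τ (sub⊢v σ h p)

  sub⊢Bs : ∀ {d m m'} {Γ : Ctx d m} {Δ : Ctx d m'} (σ : Fin m → Val d m') →
    (∀ x → Δ ⊢v σ x ∶ lookup Γ x) → ∀ {M r σs bs} →
    ⊢Branches Γ M r σs bs → ⊢Branches Δ M r σs (subEs (extV σ) bs)
  sub⊢Bs σ h [] = []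
  sub⊢Bs σ h {M} (_∷_ {σ = τ} p ps) = sub⊢ (extV σ) (⊢extV (τ [ M ]T) σ h) p ∷ sub⊢Bs σ h ps

  ⊢extV : ∀ {d m m'} {Γ : Ctx d m} {Δ : Ctx d m'} (a : Ty d) (σ : Fin m → Val d m') →
    (∀ x → Δ ⊢v σ x ∶ lookup Γ x) → ∀ x → (a ∷ Δ) ⊢v extV σ x ∶ lookup (a ∷ Γ) x
  ⊢extV a σ h zero = ⊢var zero
  ⊢extV a σ h (suc x) = ren⊢v suc (λ _ → refl) (h x)

  ⊢tweak : ∀ {d m m'} {Γ : Ctx d m} {Δ : Ctx d m'} (σ : Fin m → Val d m') →
    (∀ x → Δ ⊢v σ x ∶ lookup Γ x) → ∀ x → wkCtx Δ ⊢v tweak σ x ∶ lookup (wkCtx Γ) x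
  ⊢tweak {Γ = Γ} {Δ} σ h x =
    subst₂ (λ G t → G ⊢v tweak σ x ∶ t)
      (Vec.map-cong (subT-tvar suc (λ j → tvar (suc j)) (λ _ → refl)) Δ)
      (trans (subT-tvar suc (λ j → tvar (suc j)) (λ _ → refl) (lookup Γ x))
             (sym (Vec.lookup-map x (renT suc) Γ)))
      (tsub⊢v (λ j → tvar (suc j)) (h x))

⊢branch : ∀ {d m} {Γ : Ctx d m} {M r σs bs} → ⊢Branches Γ M r σs bs → ∀ j {e σ} →
  bs !! j ≡ just e → σs !! j ≡ just σ → ((σ [ M ]T) ∷ Γ) ⊢ e ∶ r
⊢branch [] j () _
⊢branch (p ∷ ps) zero refl refl = p
⊢branch (p ∷ ps) (suc j) eq eq' = ⊢branch ps j eq eq'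

⊢sel : ∀ {d m} {Γ : Ctx d m} (i : Fin 2) {v w a b} → Γ ⊢v v ∶ a → Γ ⊢v w ∶ b → Γ ⊢v sel i v w ∶ sel i a b
⊢sel zero p q = p
⊢sel (suc i) p q = q

⊢singleV : ∀ {v : Val 0 0} {a} → [] ⊢v v ∶ a → ∀ x → [] ⊢v singleV v x ∶ lookup (a ∷ []) x
⊢singleV p zero = p

preservation : ∀ {e e' : Tm 0 0} {a} → e ⟶[ pure ] e' → [] ⊢ e ∶ a → [] ⊢ e' ∶ a
preservation β-proj (⊢proj i (⊢pair p q)) = ⊢val (⊢sel i p q)
preservation β-ƛ (⊢app (⊢ƛ p) (⊢val q)) = sub⊢ _ (⊢singleV q) p
preservation β-Λ (⊢tapp σ (⊢Λ p)) = tsub⊢ (single σ) p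
preservation (β-case {j = j} eq) (⊢case (⊢inj eq' p) bs) = sub⊢ _ (⊢singleV p) (⊢branch bs j eq eq')
preservation (ξ-app s) (⊢app p q) = ⊢app p (preservation s q)

preservation* : ∀ {e e' : Tm 0 0} {a} → e ⇝p e' → [] ⊢ e ∶ a → [] ⊢ e' ∶ a
preservation* ε p = p
preservation* (s ◅ ss) p = preservation* ss (preservation s p)

canonical-⇒ : ∀ {v : Val 0 0} {a b} → [] ⊢v v ∶ a ⇒ b → Σ (Tm 0 1) (λ e → v ≡ ƛ e)
canonical-⇒ {var ()} _
canonical-⇒ {ƛ e} _ = e , refl

deterministic : ∀ {e e₁ e₂ : Tm 0 0} {k} → e ⟶[ pure ] e₁ → e ⟶[ k ] e₂ → (k ≡ pure) × (e₂ ≡ e₁)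
deterministic β-proj β-proj = refl , refl
deterministic β-ƛ β-ƛ = refl , refl
deterministic β-ƛ (ξ-app ())
deterministic β-Λ β-Λ = refl , refl
deterministic (β-case eq) (β-case eq') with trans (sym eq) eq'
... | refl = refl , refl
deterministic (ξ-app ()) β-ƛ
deterministic (ξ-app s) (ξ-app s') with deterministic s s'
... | refl , refl = refl , refl

ξ* : ∀ {v : Val 0 0} {e e'} → e ⇝p e' → app v e ⇝p app v e'
ξ* ε = ε
ξ* (s ◅ ss) = ξ-app s ◅ ξ* ss

val-⇝p : ∀ {v : Val 0 0} {e} → val v ⇝p e → e ≡ val v
val-⇝p ε = refl
val-⇝p (() ◅ _)

pure⇒⟶* : ∀ {e e' : Tm 0 0} → e ⇝p e' → e ⟶* e'
pure⇒⟶* ε = ε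
pure⇒⟶* (s ◅ ss) = (pure , s) ◅ pure⇒⟶* ss

data IsVal {d m : ℕ} : Tm d m → Set where
  isVal : ∀ {v} → IsVal (val v)

isVal? : ∀ {d m} (e : Tm d m) → IsVal e ⊎ ¬ IsVal e
isVal? (val v) = inj₁ isVal
isVal? ¿ = inj₂ (λ ())
isVal? (proj i v) = inj₂ (λ ())
isVal? (app v e) = inj₂ (λ ())
isVal? (case v bs) = inj₂ (λ ())
isVal? (tapp v τ) = inj₂ (λ ())

IsVal-emb : ∀ {d m} (e : Tm 0 0) → IsVal (emb {d} {m} e) → IsVal e
IsVal-emb (val x) _ = isVal

-- λr. r x, where x is the variable bound just outside.
applyArg : ∀ {d m} → Val d (suc m)
applyArg = ƛ (app (var zero) (val (var (suc zero))))

-- letApp e = λx. let r = e in r x, for a closed term e.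
letApp : Tm 0 0 → Val 0 0
letApp e = ƛ (app applyArg (emb e))

-- The expansion relation L ⊒ R ("L is R with some pure computation undone"): the
-- compatible closure of three rules on closed terms, embedded at every scope.
--   pure-run : e ⊒ e'         if e ⇝p e' and e' is not a value,
--   pure-arg : w e ⊒ w' u     if e ⇝p u and w ⊒ w',
--   let-η    : letApp W ⊒ W   for W a λ-abstraction.
-- The closed terms are given through equations t ≡ emb e to keep the indices general.
infix 4 _⊒v_ _⊒_ _⊒s_

mutual
  data _⊒v_ : {d m : ℕ} → Val d m → Val d m → Set where
    ⊒var  : ∀ {d m} (x : Fin m) → var {d} x ⊒v var x
    ⊒unit : ∀ {d m} → ⟨⟩ {d} {m} ⊒v ⟨⟩
    ⊒pair : ∀ {d m} {v v' w w' : Val d m} → v ⊒v v' → w ⊒v w' → ⟨ v , w ⟩ ⊒v ⟨ v' , w' ⟩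
    ⊒ƛ    : ∀ {d m} {e e' : Tm d (suc m)} → e ⊒ e' → ƛ e ⊒v ƛ e'
    ⊒inj  : ∀ {d m} (i : ℕ) {v v' : Val d m} → v ⊒v v' → inj i v ⊒v inj i v'
    ⊒Λ    : ∀ {d m} {e e' : Tm (suc d) m} → e ⊒ e' → Λ e ⊒v Λ e'
    let-η : ∀ {d m} (eW : Tm 0 1) {t t' : Val d m} →
            t ≡ embV (letApp (val (ƛ eW))) → t' ≡ embV (ƛ eW) → t ⊒v t'

  data _⊒_ : {d m : ℕ} → Tm d m → Tm d m → Set where
    ⊒val  : ∀ {d m} {v v' : Val d m} → v ⊒v v' → val v ⊒ val v'
    ⊒¿    : ∀ {d m} → ¿ {d} {m} ⊒ ¿
    ⊒proj : ∀ {d m} (i : Fin 2) {v v' : Val d m} → v ⊒v v' → proj i v ⊒ proj i v'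
    ⊒app  : ∀ {d m} {v v' : Val d m} {e e'} → v ⊒v v' → e ⊒ e' → app v e ⊒ app v' e'
    ⊒case : ∀ {d m} {v v' : Val d m} {bs bs'} → v ⊒v v' → bs ⊒s bs' → case v bs ⊒ case v' bs'
    ⊒tapp : ∀ {d m} {v v' : Val d m} → v ⊒v v' → (τ : Ty d) → tapp v τ ⊒ tapp v' τ
    pure-run : ∀ {d m} (e e' : Tm 0 0) {t t' : Tm d m} → e ⇝p e' → ¬ IsVal e' →
               t ≡ emb e → t' ≡ emb e' → t ⊒ t'
    pure-arg : ∀ {d m} {w w' : Val d m} → w ⊒v w' → (e : Tm 0 0) (u : Val 0 0) {t : Tm d m} {t' : Val d m} →
               e ⇝p val u → t ≡ emb e → t' ≡ embV u → app w t ⊒ app w' (val t')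

  data _⊒s_ : {d m : ℕ} → List (Tm d m) → List (Tm d m) → Set where
    []  : ∀ {d m} → [] {A = Tm d m} ⊒s []
    _∷_ : ∀ {d m} {e e' : Tm d m} {es es'} → e ⊒ e' → es ⊒s es' → (e ∷ es) ⊒s (e' ∷ es')

mutual
  ⊒v-refl : ∀ {d m} (v : Val d m) → v ⊒v v
  ⊒v-refl (var x) = ⊒var x
  ⊒v-refl ⟨⟩ = ⊒unit
  ⊒v-refl ⟨ v , w ⟩ = ⊒pair (⊒v-refl v) (⊒v-refl w)
  ⊒v-refl (ƛ e) = ⊒ƛ (⊒-refl e)
  ⊒v-refl (inj i v) = ⊒inj i (⊒v-refl v)
  ⊒v-refl (Λ e) = ⊒Λ (⊒-refl e)

  ⊒-refl : ∀ {d m} (e : Tm d m) → e ⊒ e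
  ⊒-refl (val v) = ⊒val (⊒v-refl v)
  ⊒-refl ¿ = ⊒¿
  ⊒-refl (proj i v) = ⊒proj i (⊒v-refl v)
  ⊒-refl (app v e) = ⊒app (⊒v-refl v) (⊒-refl e)
  ⊒-refl (case v bs) = ⊒case (⊒v-refl v) (⊒s-refl bs)
  ⊒-refl (tapp v τ) = ⊒tapp (⊒v-refl v) τ

  ⊒s-refl : ∀ {d m} (es : List (Tm d m)) → es ⊒s es
  ⊒s-refl [] = []
  ⊒s-refl (e ∷ es) = ⊒-refl e ∷ ⊒s-refl es

-- ⊒ is stable under renaming, type substitution and substitution of related values;
-- the special rules survive because embedded closed terms are invariant.
mutual
  ren-⊒v : ∀ {d m m'} (ρ : Fin m → Fin m') {v v' : Val d m} → v ⊒v v' → renV ρ v ⊒v renV ρ v'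
  ren-⊒v ρ (⊒var x) = ⊒var (ρ x)
  ren-⊒v ρ ⊒unit = ⊒unit
  ren-⊒v ρ (⊒pair p q) = ⊒pair (ren-⊒v ρ p) (ren-⊒v ρ q)
  ren-⊒v ρ (⊒ƛ p) = ⊒ƛ (ren-⊒ (extR ρ) p)
  ren-⊒v ρ (⊒inj i p) = ⊒inj i (ren-⊒v ρ p)
  ren-⊒v ρ (⊒Λ p) = ⊒Λ (ren-⊒ ρ p)
  ren-⊒v ρ (let-η eW eq eq') =
    let-η eW (trans (cong (renV ρ) eq) (renV-embV ρ _)) (trans (cong (renV ρ) eq') (renV-embV ρ _))

  ren-⊒ : ∀ {d m m'} (ρ : Fin m → Fin m') {e e' : Tm d m} → e ⊒ e' → renE ρ e ⊒ renE ρ e'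
  ren-⊒ ρ (⊒val p) = ⊒val (ren-⊒v ρ p)
  ren-⊒ ρ ⊒¿ = ⊒¿
  ren-⊒ ρ (⊒proj i p) = ⊒proj i (ren-⊒v ρ p)
  ren-⊒ ρ (⊒app p q) = ⊒app (ren-⊒v ρ p) (ren-⊒ ρ q)
  ren-⊒ ρ (⊒case p bs) = ⊒case (ren-⊒v ρ p) (ren-⊒s (extR ρ) bs)
  ren-⊒ ρ (⊒tapp p τ) = ⊒tapp (ren-⊒v ρ p) τ
  ren-⊒ ρ (pure-run e e' st nv eq eq') =
    pure-run e e' st nv (trans (cong (renE ρ) eq) (renE-emb ρ e)) (trans (cong (renE ρ) eq') (renE-emb ρ e'))
  ren-⊒ ρ (pure-arg p e u st eq eq') =
    pure-arg (ren-⊒v ρ p) e u st (trans (cong (renE ρ) eq) (renE-emb ρ e)) (trans (cong (renV ρ) eq') (renV-embV ρ u))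

  ren-⊒s : ∀ {d m m'} (ρ : Fin m → Fin m') {es es' : List (Tm d m)} → es ⊒s es' → renEs ρ es ⊒s renEs ρ es'
  ren-⊒s ρ [] = []
  ren-⊒s ρ (p ∷ ps) = ren-⊒ ρ p ∷ ren-⊒s ρ ps

mutual
  tsub-⊒v : ∀ {d d' m} (θ : Fin d → Ty d') {v v' : Val d m} → v ⊒v v' → tsubV θ v ⊒v tsubV θ v'
  tsub-⊒v θ (⊒var x) = ⊒var x
  tsub-⊒v θ ⊒unit = ⊒unit
  tsub-⊒v θ (⊒pair p q) = ⊒pair (tsub-⊒v θ p) (tsub-⊒v θ q)
  tsub-⊒v θ (⊒ƛ p) = ⊒ƛ (tsub-⊒ θ p)
  tsub-⊒v θ (⊒inj i p) = ⊒inj i (tsub-⊒v θ p)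
  tsub-⊒v θ (⊒Λ p) = ⊒Λ (tsub-⊒ (extS θ) p)
  tsub-⊒v θ (let-η eW eq eq') =
    let-η eW (trans (cong (tsubV θ) eq) (tsubV-embV θ _)) (trans (cong (tsubV θ) eq') (tsubV-embV θ _))

  tsub-⊒ : ∀ {d d' m} (θ : Fin d → Ty d') {e e' : Tm d m} → e ⊒ e' → tsubE θ e ⊒ tsubE θ e'
  tsub-⊒ θ (⊒val p) = ⊒val (tsub-⊒v θ p)
  tsub-⊒ θ ⊒¿ = ⊒¿
  tsub-⊒ θ (⊒proj i p) = ⊒proj i (tsub-⊒v θ p)
  tsub-⊒ θ (⊒app p q) = ⊒app (tsub-⊒v θ p) (tsub-⊒ θ q)
  tsub-⊒ θ (⊒case p bs) = ⊒case (tsub-⊒v θ p) (tsub-⊒s θ bs)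
  tsub-⊒ θ (⊒tapp p τ) = ⊒tapp (tsub-⊒v θ p) (subT θ τ)
  tsub-⊒ θ (pure-run e e' st nv eq eq') =
    pure-run e e' st nv (trans (cong (tsubE θ) eq) (tsubE-emb θ e)) (trans (cong (tsubE θ) eq') (tsubE-emb θ e'))
  tsub-⊒ θ (pure-arg p e u st eq eq') =
    pure-arg (tsub-⊒v θ p) e u st (trans (cong (tsubE θ) eq) (tsubE-emb θ e)) (trans (cong (tsubV θ) eq') (tsubV-embV θ u))

  tsub-⊒s : ∀ {d d' m} (θ : Fin d → Ty d') {es es' : List (Tm d m)} → es ⊒s es' → tsubEs θ es ⊒s tsubEs θ es'
  tsub-⊒s θ [] = []
  tsub-⊒s θ (p ∷ ps) = tsub-⊒ θ p ∷ tsub-⊒s θ ps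

mutual
  sub-⊒v : ∀ {d m m'} {σ σ' : Fin m → Val d m'} → (∀ x → σ x ⊒v σ' x) →
    {v v' : Val d m} → v ⊒v v' → subV σ v ⊒v subV σ' v'
  sub-⊒v h (⊒var x) = h x
  sub-⊒v h ⊒unit = ⊒unit
  sub-⊒v h (⊒pair p q) = ⊒pair (sub-⊒v h p) (sub-⊒v h q)
  sub-⊒v h (⊒ƛ p) = ⊒ƛ (sub-⊒ (ext-⊒ h) p)
  sub-⊒v h (⊒inj i p) = ⊒inj i (sub-⊒v h p)
  sub-⊒v h (⊒Λ p) = ⊒Λ (sub-⊒ (λ x → tsub-⊒v (λ j → tvar (suc j)) (h x)) p)
  sub-⊒v {σ = σ} {σ'} h (let-η eW eq eq') =
    let-η eW (trans (cong (subV σ) eq) (subV-embV σ _)) (trans (cong (subV σ') eq') (subV-embV σ' _))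

  sub-⊒ : ∀ {d m m'} {σ σ' : Fin m → Val d m'} → (∀ x → σ x ⊒v σ' x) →
    {e e' : Tm d m} → e ⊒ e' → subE σ e ⊒ subE σ' e'
  sub-⊒ h (⊒val p) = ⊒val (sub-⊒v h p)
  sub-⊒ h ⊒¿ = ⊒¿
  sub-⊒ h (⊒proj i p) = ⊒proj i (sub-⊒v h p)
  sub-⊒ h (⊒app p q) = ⊒app (sub-⊒v h p) (sub-⊒ h q)
  sub-⊒ h (⊒case p bs) = ⊒case (sub-⊒v h p) (sub-⊒s (ext-⊒ h) bs)
  sub-⊒ h (⊒tapp p τ) = ⊒tapp (sub-⊒v h p) τ
  sub-⊒ {σ = σ} {σ'} h (pure-run e e' st nv eq eq') =
    pure-run e e' st nv (trans (cong (subE σ) eq) (subE-emb σ e)) (trans (cong (subE σ') eq') (subE-emb σ' e'))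
  sub-⊒ {σ = σ} {σ'} h (pure-arg p e u st eq eq') =
    pure-arg (sub-⊒v h p) e u st (trans (cong (subE σ) eq) (subE-emb σ e)) (trans (cong (subV σ') eq') (subV-embV σ' u))

  sub-⊒s : ∀ {d m m'} {σ σ' : Fin m → Val d m'} → (∀ x → σ x ⊒v σ' x) →
    {es es' : List (Tm d m)} → es ⊒s es' → subEs σ es ⊒s subEs σ' es'
  sub-⊒s h [] = []
  sub-⊒s h (p ∷ ps) = sub-⊒ h p ∷ sub-⊒s h ps

  ext-⊒ : ∀ {d m m'} {σ σ' : Fin m → Val d m'} → (∀ x → σ x ⊒v σ' x) → ∀ x → extV σ x ⊒v extV σ' x
  ext-⊒ h zero = ⊒var zero
  ext-⊒ h (suc x) = ren-⊒v suc (h x)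

single-⊒ : ∀ {u u' : Val 0 0} → u ⊒v u' → ∀ x → singleV u x ⊒v singleV u' x
single-⊒ p zero = p

-- ⊒ relates values exactly to values (pure-run never has a value on its right, and its
-- left side cannot be a value since values do not reduce).
⊒-val-left : ∀ {d m} {v : Val d m} {t} → val v ⊒ t → Σ (Val d m) (λ v' → (t ≡ val v') × v ⊒v v')
⊒-val-left (⊒val p) = _ , refl , p
⊒-val-left (pure-run e e' st nv eq eq') with IsVal-emb e (subst IsVal eq isVal)
⊒-val-left (pure-run (val x) e' st nv eq eq') | isVal = ⊥-elim (nv (subst IsVal (sym (val-⇝p st)) isVal))

⊒-val-right : ∀ {d m} {v' : Val d m} {t} → t ⊒ val v' → Σ (Val d m) (λ v → (t ≡ val v) × v ⊒v v')
⊒-val-right (⊒val p) = _ , refl , p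
⊒-val-right (pure-run e e' st nv eq eq') = ⊥-elim (nv (IsVal-emb e' (subst IsVal eq' isVal)))

⊒-nonval : ∀ {d m} {t t' : Tm d m} → t ⊒ t' → ¬ IsVal t' → ¬ IsVal t
⊒-nonval p nv isVal with ⊒-val-left p
... | _ , refl , _ = nv isVal

-- Aligned pairs answer every
-- step of either side, which is what both adequacy proofs consume.

RightAnswer : Tm 0 0 → Kind → Tm 0 0 → Set
RightAnswer R k L₂ = Σ (Tm 0 0) λ R₂ → Σ (Tm 0 0) λ L₃ → (R ⟶[ k ] R₂) × (L₂ ⇝p L₃) × (L₃ ⊒ R₂)

LeftAnswer : Tm 0 0 → Kind → Tm 0 0 → Set
LeftAnswer L k R₂ = Σ (Tm 0 0) λ L₂ → Σ (Tm 0 0) λ L₃ → (L ⟶[ k ] L₂) × (L₂ ⇝p L₃) × (L₃ ⊒ R₂)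

record Aligned (L R : Tm 0 0) : Set where
  field
    forth : ∀ {k L₂} → L ⟶[ k ] L₂ → RightAnswer R k L₂
    back  : ∀ {k R₂} → R ⟶[ k ] R₂ → LeftAnswer L k R₂

open Aligned

aligned-refl : (e : Tm 0 0) → Aligned e e
aligned-refl e = record { forth = λ s → _ , _ , s , ε , ⊒-refl _ ; back = λ s → _ , _ , s , ε , ⊒-refl _ }

let-η-left : ∀ {t : Val 0 0} (eW : Tm 0 1) → t ≡ embV (letApp (val (ƛ eW))) → t ≡ letApp (val (ƛ eW))
let-η-left eW eq = trans eq (embV-closed _)

let-η-right : ∀ {t : Val 0 0} (eW : Tm 0 1) → t ≡ embV (ƛ eW) → t ≡ ƛ eW
let-η-right eW eq = trans eq (embV-closed _)

-- After its first β-step, letApp (λx.e) u reaches e[u/x] by two more pure steps.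
letApp-β : (eW : Tm 0 1) (u : Val 0 0) → ((app applyArg (emb (val (ƛ eW)))) [ u ]v) ⇝p (eW [ u ]v)
letApp-β eW u =
  subst (λ x → app (ƛ (app (var zero) (val (renV suc u)))) (val x) ⇝p (eW [ u ]v))
        (sym (trans (subV-embV (singleV u) (ƛ eW)) (embV-closed (ƛ eW))))
        (β-ƛ ◅ subst (λ x → app (ƛ eW) (val x) ⇝p (eW [ u ]v)) (sym u-unchanged) (β-ƛ ◅ ε))
  where
  u-unchanged : subV (singleV (ƛ eW)) (renV suc u) ≡ u
  u-unchanged = trans (subV-renV suc (singleV (ƛ eW)) var (λ _ → refl) u) (subV-id var (λ _ → refl) u)

aligned-β : ∀ {v v' u u' : Val 0 0} → v ⊒v v' → u ⊒v u' → Aligned (app v (val u)) (app v' (val u'))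
aligned-β {u = u} p q = record { forth = forth' p ; back = back' p }
  where
  forth' : ∀ {v v' k L₂} → v ⊒v v' → app v (val u) ⟶[ k ] L₂ → RightAnswer (app v' (val _)) k L₂
  forth' (⊒ƛ r) β-ƛ = _ , _ , β-ƛ , ε , sub-⊒ (single-⊒ q) r
  forth' (let-η eW eq eq') β-ƛ with let-η-left eW eq | let-η-right eW eq'
  ... | refl | refl = _ , _ , β-ƛ , letApp-β eW u , sub-⊒ (single-⊒ q) (⊒-refl eW)
  forth' _ (ξ-app ())
  back' : ∀ {v v' k R₂} → v ⊒v v' → app v' (val _) ⟶[ k ] R₂ → LeftAnswer (app v (val u)) k R₂
  back' (⊒ƛ r) β-ƛ = _ , _ , β-ƛ , ε , sub-⊒ (single-⊒ q) r
  back' (let-η eW eq eq') β-ƛ with let-η-left eW eq | let-η-right eW eq'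
  ... | refl | refl = _ , _ , β-ƛ , letApp-β eW u , sub-⊒ (single-⊒ q) (⊒-refl eW)
  back' _ (ξ-app ())

sel-⊒ : ∀ (i : Fin 2) {a a' b b' : Val 0 0} → a ⊒v a' → b ⊒v b' → sel i a b ⊒v sel i a' b'
sel-⊒ zero p q = p
sel-⊒ (suc i) p q = q

aligned-proj : ∀ (i : Fin 2) {v v' : Val 0 0} → v ⊒v v' → Aligned (proj i v) (proj i v')
aligned-proj i p = record { forth = forth' p ; back = back' p }
  where
  forth' : ∀ {v v' k L₂} → v ⊒v v' → proj i v ⟶[ k ] L₂ → RightAnswer (proj i v') k L₂
  forth' (⊒pair a b) β-proj = _ , _ , β-proj , ε , ⊒val (sel-⊒ i a b)
  forth' (let-η eW eq eq') β-proj with let-η-left eW eq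
  ... | ()
  back' : ∀ {v v' k R₂} → v ⊒v v' → proj i v' ⟶[ k ] R₂ → LeftAnswer (proj i v) k R₂
  back' (⊒pair a b) β-proj = _ , _ , β-proj , ε , ⊒val (sel-⊒ i a b)
  back' (let-η eW eq eq') β-proj with let-η-right eW eq'
  ... | ()

aligned-tapp : ∀ {v v' : Val 0 0} → v ⊒v v' → (τ : Ty 0) → Aligned (tapp v τ) (tapp v' τ)
aligned-tapp p τ = record { forth = forth' p ; back = back' p }
  where
  forth' : ∀ {v v' k L₂} → v ⊒v v' → tapp v τ ⟶[ k ] L₂ → RightAnswer (tapp v' τ) k L₂
  forth' (⊒Λ r) β-Λ = _ , _ , β-Λ , ε , tsub-⊒ (single τ) r
  forth' (let-η eW eq eq') β-Λ with let-η-left eW eq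
  ... | ()
  back' : ∀ {v v' k R₂} → v ⊒v v' → tapp v' τ ⟶[ k ] R₂ → LeftAnswer (tapp v τ) k R₂
  back' (⊒Λ r) β-Λ = _ , _ , β-Λ , ε , tsub-⊒ (single τ) r
  back' (let-η eW eq eq') β-Λ with let-η-right eW eq'
  ... | ()

branch-right : ∀ {d m} {bs bs' : List (Tm d m)} → bs ⊒s bs' → ∀ j {e} → bs !! j ≡ just e →
  Σ (Tm d m) λ e' → (bs' !! j ≡ just e') × (e ⊒ e')
branch-right [] j ()
branch-right (p ∷ ps) zero refl = _ , refl , p
branch-right (p ∷ ps) (suc j) eq = branch-right ps j eq

branch-left : ∀ {d m} {bs bs' : List (Tm d m)} → bs ⊒s bs' → ∀ j {e'} → bs' !! j ≡ just e' →
  Σ (Tm d m) λ e → (bs !! j ≡ just e) × (e ⊒ e')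
branch-left [] j ()
branch-left (p ∷ ps) zero refl = _ , refl , p
branch-left (p ∷ ps) (suc j) eq = branch-left ps j eq

aligned-case : ∀ {v v' : Val 0 0} {bs bs'} → v ⊒v v' → bs ⊒s bs' → Aligned (case v bs) (case v' bs')
aligned-case {bs = bs} {bs'} p ps = record { forth = forth' p ; back = back' p }
  where
  forth' : ∀ {v v' k L₂} → v ⊒v v' → case v bs ⟶[ k ] L₂ → RightAnswer (case v' bs') k L₂
  forth' (⊒inj j q) (β-case eq) with branch-right ps j eq
  ... | e' , eq' , r = _ , _ , β-case eq' , ε , sub-⊒ (single-⊒ q) r
  forth' (let-η eW eq₁ eq₂) (β-case eq) with let-η-left eW eq₁
  ... | ()
  back' : ∀ {v v' k R₂} → v ⊒v v' → case v' bs' ⟶[ k ] R₂ → LeftAnswer (case v bs) k R₂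
  back' (⊒inj j q) (β-case eq) with branch-left ps j eq
  ... | e , eq' , r = _ , _ , β-case eq' , ε , sub-⊒ (single-⊒ q) r
  back' (let-η eW eq₁ eq₂) (β-case eq) with let-η-right eW eq₂
  ... | ()

aligned-ξ : ∀ {v v' : Val 0 0} {e e'} → v ⊒v v' → ¬ IsVal e → ¬ IsVal e' → Aligned e e' →
  Aligned (app v e) (app v' e')
aligned-ξ p nv nv' al = record { forth = forth' ; back = back' }
  where
  forth' : ∀ {k L₂} → app _ _ ⟶[ k ] L₂ → RightAnswer (app _ _) k L₂
  forth' β-ƛ = ⊥-elim (nv isVal)
  forth' (ξ-app s) with forth al s
  ... | _ , _ , s' , st , q = _ , _ , ξ-app s' , ξ* st , ⊒app p q
  back' : ∀ {k R₂} → app _ _ ⟶[ k ] R₂ → LeftAnswer (app _ _) k R₂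
  back' β-ƛ = ⊥-elim (nv' isVal)
  back' (ξ-app s) with back al s
  ... | _ , _ , s' , st , q = _ , _ , ξ-app s' , ξ* st , ⊒app p q

align : ∀ {L R : Tm 0 0} → L ⊒ R → Σ (Tm 0 0) λ L* → (L ⇝p L*) × (L* ⊒ R) × Aligned L* R
align (⊒val p) = _ , ε , ⊒val p , record { forth = λ () ; back = λ () }
align ⊒¿ = _ , ε , ⊒¿ , aligned-refl ¿
align (⊒proj i p) = _ , ε , ⊒proj i p , aligned-proj i p
align (⊒case p ps) = _ , ε , ⊒case p ps , aligned-case p ps
align (⊒tapp p τ) = _ , ε , ⊒tapp p τ , aligned-tapp p τ
align (⊒app {e' = e'} p q) with isVal? e'
align (⊒app {e' = val u'} p q) | inj₁ isVal with ⊒-val-right q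
... | u , refl , r = _ , ε , ⊒app p q , aligned-β p r
align (⊒app p q) | inj₂ nv' with align q
... | e* , st , q* , al = _ , ξ* st , ⊒app p q* , aligned-ξ p (⊒-nonval q* nv') nv' al
align (pure-run e e' st nv eq eq') with trans eq (emb-closed e) | trans eq' (emb-closed e')
... | refl | refl = e' , st , ⊒-refl e' , aligned-refl e'
align (pure-arg p e u st eq eq') with trans eq (emb-closed e) | trans eq' (embV-closed u)
... | refl | refl = _ , ξ* st , ⊒app p (⊒val (⊒v-refl u)) , aligned-β p (⊒v-refl u)

-- Forward: induction on the run of the left
-- side, generalised over a pure prefix L ⇝p L' (determinism lets that prefix be
-- absorbed into the run).

converges-forward : ∀ {L L' R : Tm 0 0} {v} → L ⟶* val v → L ⇝p L' → L' ⊒ R → R ↓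
converges-forward ε st p with val-⇝p st
... | refl with ⊒-val-left p
... | v' , refl , _ = v' , ε
converges-forward ((k , s) ◅ q) (s₀ ◅ st) p with deterministic s₀ s
... | refl , refl = converges-forward q st p
converges-forward ((k , s) ◅ q) ε p with align p
... | _ , s₀ ◅ st , p* , _ with deterministic s₀ s
...   | refl , refl = converges-forward q st p*
converges-forward ((k , s) ◅ q) ε p | _ , ε , _ , al with forth al s
... | _ , _ , sR , st₃ , p₃ with converges-forward q st₃ p₃
...   | v , run = v , (k , sR) ◅ run

converges-backward : ∀ {L R : Tm 0 0} {v} → L ⊒ R → R ⟶* val v → L ↓
converges-backward p run with align p
converges-backward p ε | _ , st , p* , _ with ⊒-val-right p*
... | v , refl , _ = v , pure⇒⟶* st
converges-backward p ((k , s) ◅ run) | _ , st , _ , al with back al s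
... | _ , _ , sL , st₂ , p₂ with converges-backward p₂ run
...   | v , run' = v , pure⇒⟶* st ◅◅ ((k , sL) ◅ (pure⇒⟶* st₂ ◅◅ run'))

⊒-may : ∀ {L R : Tm 0 0} → L ⊒ R → (L ↓ → R ↓) × (R ↓ → L ↓)
⊒-may p = (λ { (_ , run) → converges-forward run ε p }) , (λ { (_ , run) → converges-backward p run })

Diverges : Tm 0 0 → Set
Diverges e = Σ (ℕ → Tm 0 0) (λ s → (s 0 ≡ e) × ((n : ℕ) → s n ⟶ s (suc n)))

record Pending {A : Set} (T : A → A → Set) (P : A → Set) : Set where
  constructor pending
  field
    current : A
    target  : A
    path    : Star T current target
    target-ok : P target

infinite-sequence : ∀ {A : Set} (T : A → A → Set) (P : A → Set) →
  (∀ {a} → P a → Σ A λ b → P b × Σ A (λ x → T a x × Star T x b)) →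
  ∀ {a} → P a → Σ (ℕ → A) λ s → (s 0 ≡ a) × ((n : ℕ) → T (s n) (s (suc n)))
infinite-sequence {A} T P progress {a} pa =
  (λ n → Pending.current (states n)) , refl , (λ n → proj₂ (advance (states n)))
  where
  advance : (x : Pending T P) → Σ (Pending T P) λ y → T (Pending.current x) (Pending.current y)
  advance (pending c t ε ok) with progress ok
  ... | b , ok' , x , tx , xs = pending x b xs ok' , tx
  advance (pending c t (tx ◅ xs) ok) = pending _ t xs ok , tx
  states : ℕ → Pending T P
  states zero = pending a a ε pa
  states (suc n) = proj₁ (advance (states n))

-- A reduction sequence through X follows every pure path out of X (determinism).
passes-through : (s : ℕ → Tm 0 0) → ((n : ℕ) → s n ⟶ s (suc n)) →
  ∀ j {X Y} → s j ≡ X → X ⇝p Y → Σ ℕ λ j' → s j' ≡ Y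
passes-through s steps j eq ε = j , eq
passes-through s steps j refl (x ◅ xs) with steps j
... | k , x' with deterministic x x'
... | refl , eq' = passes-through s steps (suc j) eq' xs

diverges-forward : ∀ {L R : Tm 0 0} → L ⊒ R → Diverges L → Diverges R
diverges-forward {L} {R} p (s , s0 , steps) =
  infinite-sequence _⟶_ Tracks progress (0 , subst (λ x → x ⊒ R) (sym s0) p)
  where
  Tracks : Tm 0 0 → Set
  Tracks R' = Σ ℕ λ j → s j ⊒ R'
  progress : ∀ {a} → Tracks a → Σ (Tm 0 0) λ b → Tracks b × Σ (Tm 0 0) (λ x → a ⟶ x × Star _⟶_ x b)
  progress (j , q) with align q
  ... | _ , st₁ , _ , al with passes-through s steps j refl st₁
  ... | j₁ , eq₁ with steps j₁
  ... | k , x with forth al (subst (λ z → z ⟶[ k ] s (suc j₁)) eq₁ x)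
  ... | R₂ , _ , sR , st₃ , q₃ with passes-through s steps (suc j₁) refl st₃
  ... | j₂ , eq₂ = R₂ , (j₂ , subst (λ z → z ⊒ R₂) (sym eq₂) q₃) , (R₂ , (k , sR) , ε)

diverges-backward : ∀ {L R : Tm 0 0} → L ⊒ R → Diverges R → Diverges L
diverges-backward {L} {R} p (r , r0 , steps) =
  infinite-sequence _⟶_ Tracked progress (0 , subst (λ x → L ⊒ x) (sym r0) p)
  where
  Tracked : Tm 0 0 → Set
  Tracked L' = Σ ℕ λ k → L' ⊒ r k
  nonempty : ∀ {a x y b : Tm 0 0} {k} → a ⇝p x → x ⟶[ k ] y → y ⇝p b →
    Σ (Tm 0 0) (λ z → a ⟶ z × Star _⟶_ z b)
  nonempty ε s st = _ , (_ , s) , pure⇒⟶* st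
  nonempty (s₀ ◅ st₀) s st = _ , (pure , s₀) , (pure⇒⟶* st₀ ◅◅ ((_ , s) ◅ pure⇒⟶* st))
  progress : ∀ {a} → Tracked a → Σ (Tm 0 0) λ b → Tracked b × Σ (Tm 0 0) (λ x → a ⟶ x × Star _⟶_ x b)
  progress (k , q) with align q
  ... | _ , st₁ , _ , al with steps k
  ... | _ , x with back al x
  ... | _ , L₃ , sL , st₃ , q₃ = L₃ , (suc k , q₃) , nonempty st₁ sL st₃

⊒-must : ∀ {L R : Tm 0 0} → L ⊒ R → (L ⇓ → R ⇓) × (R ⇓ → L ⇓)
⊒-must p = (λ L⇓ R⇑ → L⇓ (diverges-backward p R⇑)) , (λ R⇓ L⇑ → R⇓ (diverges-forward p L⇑))

infix 4 _≈_ _≈v_ _≈s_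

_≈_ : ∀ {d m} → Tm d m → Tm d m → Set
_≈_ = EqClosure _⊒_

_≈v_ : ∀ {d m} → Val d m → Val d m → Set
_≈v_ = EqClosure _⊒v_

_≈s_ : ∀ {d m} → List (Tm d m) → List (Tm d m) → Set
_≈s_ = EqClosure _⊒s_

≈-invariant : (P : Tm 0 0 → Set) → (∀ {L R} → L ⊒ R → (P L → P R) × (P R → P L)) →
  ∀ {e e'} → e ≈ e' → P e → P e'
≈-invariant P inv ε pe = pe
≈-invariant P inv (fwd p ◅ ps) pe = ≈-invariant P inv ps (proj₁ (inv p) pe)
≈-invariant P inv (bwd p ◅ ps) pe = ≈-invariant P inv ps (proj₂ (inv p) pe)

≈-val : ∀ {d m} {v v' : Val d m} → val v ≈ val v' → v ≈v v'
≈-val ε = ε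
≈-val (fwd p ◅ ps) with ⊒-val-left p
... | _ , refl , q = fwd q ◅ ≈-val ps
≈-val (bwd p ◅ ps) with ⊒-val-right p
... | _ , refl , q = bwd q ◅ ≈-val ps

Equated : TRel
Equated Γ e e' τ = (Γ ⊢ e ∶ τ) × (Γ ⊢ e' ∶ τ) × e ≈ e'

-- ≈ is a congruence for the term formers with two immediate subterms: change one
-- subterm at a time.
≈-pair : ∀ {d m} {v v' w w' : Val d m} → v ≈v v' → w ≈v w' → val ⟨ v , w ⟩ ≈ val ⟨ v' , w' ⟩
≈-pair {v' = v'} {w = w} e e' =
  EqClosure.gmap (λ x → val ⟨ x , w ⟩) (λ r → ⊒val (⊒pair r (⊒v-refl w))) e ◅◅
  EqClosure.gmap (λ x → val ⟨ v' , x ⟩) (λ r → ⊒val (⊒pair (⊒v-refl v') r)) e'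

≈-app : ∀ {d m} {v v' : Val d m} {e e'} → v ≈v v' → e ≈ e' → app v e ≈ app v' e'
≈-app {v' = v'} {e = e} p q =
  EqClosure.gmap (λ x → app x e) (λ r → ⊒app r (⊒-refl e)) p ◅◅
  EqClosure.gmap (app v') (⊒app (⊒v-refl v')) q

≈-case : ∀ {d m} {v v' : Val d m} {bs bs'} → v ≈v v' → bs ≈s bs' → case v bs ≈ case v' bs'
≈-case {v' = v'} {bs = bs} p q =
  EqClosure.gmap (λ x → case x bs) (λ r → ⊒case r (⊒s-refl bs)) p ◅◅
  EqClosure.gmap (case v') (⊒case (⊒v-refl v')) q

≈-∷ : ∀ {d m} {b b' : Tm d m} {bs bs'} → b ≈ b' → bs ≈s bs' → (b ∷ bs) ≈s (b' ∷ bs')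
≈-∷ {b' = b'} {bs = bs} p q =
  EqClosure.gmap (_∷ bs) (_∷ ⊒s-refl bs) p ◅◅ EqClosure.gmap (b' ∷_) (⊒-refl b' ∷_) q

⊢val⁻ : ∀ {d m} {Γ : Ctx d m} {v a} → Γ ⊢ val v ∶ a → Γ ⊢v v ∶ a
⊢val⁻ (⊢val p) = p

equated-branches : ∀ {d m} {Γ : Ctx d m} {M r σs bs bs'} → RelBranches Equated Γ M r σs bs bs' →
  ⊢Branches Γ M r σs bs × ⊢Branches Γ M r σs bs' × bs ≈s bs'
equated-branches [] = [] , [] , ε
equated-branches ((p , p' , e) ∷ ps) with equated-branches ps
... | qs , qs' , es = p ∷ qs , p' ∷ qs' , ≈-∷ e es

equated-case : ∀ {d m} {Γ : Ctx d m} {v v' bs bs' a as ρ} → Equated Γ (val v) (val v') (μ a as) →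
  RelBranches Equated Γ (μ a as) ρ (a ∷ as) bs bs' → Equated Γ (case v bs) (case v' bs') ρ
equated-case (p , p' , e) rb with equated-branches rb
... | qs , qs' , es = ⊢case (⊢val⁻ p) qs , ⊢case (⊢val⁻ p') qs' , ≈-case (≈-val e) es

equated-compatible : Compatible Equated
equated-compatible = record
  { c-var = λ x → ⊢val (⊢var x) , ⊢val (⊢var x) , ε
  ; c-unit = ⊢val ⊢unit , ⊢val ⊢unit , ε
  ; c-¿ = ⊢¿ , ⊢¿ , ε
  ; c-pair = λ { (p , p' , e) (q , q' , e') →
      ⊢val (⊢pair (⊢val⁻ p) (⊢val⁻ q)) , ⊢val (⊢pair (⊢val⁻ p') (⊢val⁻ q')) , ≈-pair (≈-val e) (≈-val e') }
  ; c-ƛ = λ { (p , p' , e) → ⊢val (⊢ƛ p) , ⊢val (⊢ƛ p') ,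
      EqClosure.gmap (λ x → val (ƛ x)) (λ r → ⊒val (⊒ƛ r)) e }
  ; c-inj = λ { {i = i} eq (p , p' , e) → ⊢val (⊢inj eq (⊢val⁻ p)) , ⊢val (⊢inj eq (⊢val⁻ p')) ,
      EqClosure.gmap (λ x → val (inj i x)) (λ r → ⊒val (⊒inj i r)) (≈-val e) }
  ; c-Λ = λ { (p , p' , e) → ⊢val (⊢Λ p) , ⊢val (⊢Λ p') ,
      EqClosure.gmap (λ x → val (Λ x)) (λ r → ⊒val (⊒Λ r)) e }
  ; c-proj = λ { i (p , p' , e) → ⊢proj i (⊢val⁻ p) , ⊢proj i (⊢val⁻ p') ,
      EqClosure.gmap (proj i) (⊒proj i) (≈-val e) }
  ; c-app = λ { (p , p' , e) (q , q' , e') → ⊢app (⊢val⁻ p) q , ⊢app (⊢val⁻ p') q' , ≈-app (≈-val e) e' }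
  ; c-case = equated-case
  ; c-tapp = λ { σ (p , p' , e) → ⊢tapp σ (⊢val⁻ p) , ⊢tapp σ (⊢val⁻ p') ,
      EqClosure.gmap (λ x → tapp x σ) (λ r → ⊒tapp r σ) (≈-val e) }
  }

≈-precongruence : Precongruence Equated
≈-precongruence = record
  { type-indexed = record { typed = λ { (p , p' , _) → p , p' } }
  ; refl = λ p → p , p , ε
  ; trans = λ { (p , _ , e) (_ , q , e') → p , q , (e ◅◅ e') }
  ; compatible = equated-compatible
  }

≈-may-adequate : MayAdequate Equated
≈-may-adequate (_ , _ , e) = ≈-invariant _↓ ⊒-may e

≈-must-adequate : MustAdequate Equated
≈-must-adequate (_ , _ , e) = ≈-invariant _⇓ ⊒-must e

-- Terms related by ≈ and of the same type are contextually equivalent, for both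
-- observables: ≈ restricted to typed pairs is one of the adequate precongruences.
≈⇒≅ : ∀ {d m} {Γ : Ctx d m} {e e' τ} → Γ ⊢ e ∶ τ → Γ ⊢ e' ∶ τ → e ≈ e' →
  (Γ ⊢ e ≅⇓ e' ∶ τ) × (Γ ⊢ e ≅↓ e' ∶ τ)
≈⇒≅ ⊢e ⊢e' e≈e' =
  ((Equated , ≈-precongruence , ≈-must-adequate , (⊢e , ⊢e' , e≈e')) ,
   (Equated , ≈-precongruence , ≈-must-adequate , (⊢e' , ⊢e , e≈e'⁻¹))) ,
  ((Equated , ≈-precongruence , ≈-may-adequate , (⊢e , ⊢e' , e≈e')) ,
   (Equated , ≈-precongruence , ≈-may-adequate , (⊢e' , ⊢e , e≈e'⁻¹)))
  where
  e≈e'⁻¹ = EqClosure.symmetric _⊒_ e≈e'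

-- The unfolding of fix.  δ⟨ x ⟩ is δ_f = λy. case y of (in y' ⇒ x (λx'. let r = y' y in r x'))
-- with the occurrence of f given as a leaf x; renaming and substitution act on δ⟨ x ⟩
-- only through that leaf, definitionally.
δ⟨_⟩ : ∀ {d m} → Val d (suc (suc m)) → Val d m
δ⟨ x ⟩ = ƛ (case (var zero)
  (app x (val (ƛ (app applyArg (app (var (suc zero)) (val (var (suc (suc zero)))))))) ∷ []))

Ω⟨_⟩ : ∀ {d m} → Val d (suc (suc m)) → Tm d m
Ω⟨ x ⟩ = app δ⟨ x ⟩ (val (inj 0 δ⟨ x ⟩))

-- Ω_f = δ_f (in δ_f), the term fix[τ][τ'] f reduces to.
Ω : Val 0 0 → Tm 0 0
Ω f = Ω⟨ embV f ⟩

Ω-leaves : ∀ {d m} {a b : Val d (suc (suc m))} (f : Val 0 0) → a ≡ embV f → b ≡ embV f →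
  app δ⟨ a ⟩ (val (inj 0 δ⟨ b ⟩)) ≡ Ω⟨ embV f ⟩
Ω-leaves f refl refl = refl

emb-Ω : ∀ {m} (f : Val 0 0) → emb {0} {m} (Ω f) ≡ Ω⟨ embV f ⟩
emb-Ω f = Ω-leaves f leaf leaf
  where leaf = trans (cong (renV _) (tsubV-embV _ f)) (renV-embV _ f)

fix-unfolds : (τ τ' : Ty 0) (f : Val 0 0) → (fix[ τ ][ τ' ] f) ⇝p Ω f
fix-unfolds τ τ' f =
  subst (λ x → (fix[ τ ][ τ' ] f) ⇝p Ω⟨ x ⟩) leaf (ξ-app β-Λ ◅ β-ƛ ◅ ξ-app β-Λ ◅ β-ƛ ◅ β-ƛ ◅ ε)
  where
  -- f enters under two binders of fix, is substituted twice, and is weakened twice by δ.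
  leaf : ∀ {σ₁ : Fin 2 → Val 0 1} {σ₂ : Fin 1 → Val 0 0} →
    renV suc (renV suc (subV σ₂ (subV σ₁ (weaken0 f)))) ≡ embV f
  leaf {σ₁} {σ₂} = begin
    renV suc (renV suc (subV σ₂ (subV σ₁ (weaken0 f))))
      ≡⟨ cong (λ z → renV suc (renV suc (subV σ₂ (subV σ₁ z)))) (weaken0-embV f) ⟩
    renV suc (renV suc (subV σ₂ (subV σ₁ (embV f))))
      ≡⟨ cong (λ z → renV suc (renV suc (subV σ₂ z))) (subV-embV σ₁ f) ⟩
    renV suc (renV suc (subV σ₂ (embV f)))
      ≡⟨ cong (λ z → renV suc (renV suc z)) (subV-embV σ₂ f) ⟩
    renV suc (renV suc (embV f))
      ≡⟨ cong (renV suc) (renV-embV suc f) ⟩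
    renV suc (embV f)
      ≡⟨ renV-embV suc f ⟩
    embV f
      ∎
    where open ≡-Reasoning

-- Ω_f ⇝p f g_f  with  g_f = λx. let r = Ω_f in r x: one β-step and one case-step, after
-- which every copy of f is again (equal to) the embedded f.
Ω-unfolds : (f : Val 0 0) → Ω f ⇝p app f (val (letApp (Ω f)))
Ω-unfolds f =
  subst (Ω f ⇝p_) (cong₂ (λ h t → app h (val (ƛ (app applyArg t)))) head (body leaf)) (β-ƛ ◅ β-case refl ◅ ε)
  where
  head : ∀ {σ₁ : Fin 2 → Val 0 1} {σ₂ : Fin 1 → Val 0 0} → subV σ₂ (subV σ₁ (embV f)) ≡ f
  head {σ₁} {σ₂} = trans (cong (subV σ₂) (subV-embV σ₁ f)) (trans (subV-embV σ₂ f) (embV-closed f))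
  leaf : ∀ {ρ₁ : Fin 2 → Fin 3} {ρ₂ : Fin 3 → Fin 4} {σ : Fin 4 → Val 0 3} →
    subV σ (renV ρ₂ (renV ρ₁ (embV f))) ≡ embV f
  leaf {ρ₁} {ρ₂} {σ} =
    trans (cong (subV σ) (trans (cong (renV ρ₂) (renV-embV ρ₁ f)) (renV-embV ρ₂ f))) (subV-embV σ f)
  body : ∀ {ρ : Fin 2 → Fin 3} {b} → b ≡ embV f →
    app δ⟨ renV ρ (embV f) ⟩ (val (inj 0 δ⟨ b ⟩)) ≡ emb (Ω f)
  body b≡f = trans (Ω-leaves f (renV-embV _ f) b≡f) (sym (emb-Ω f))

-- α → β inside the body of fix, where α is type variable 1 and β is type variable 0.
α⇒β : Ty 2
α⇒β = tvar (suc zero) ⇒ tvar zero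

-- μγ. γ → (α → β), the recursive type of the argument of δ_f.
self-type : Ty 2
self-type = μ (tvar zero ⇒ renT suc α⇒β) []

⊢δV : ((α⇒β ⇒ α⇒β) ∷ []) ⊢v δV ∶ (self-type ⇒ α⇒β)
⊢δV = ⊢ƛ (⊢case (⊢var zero)
        (⊢app (⊢var (suc (suc zero)))
              (⊢val (⊢ƛ (⊢app (⊢ƛ (⊢app (⊢var zero) (⊢val (⊢var (suc zero)))))
                              (⊢app (⊢var (suc zero)) (⊢val (⊢var (suc (suc zero))))))))
         ∷ []))

⊢fix : [] ⊢v fix ∶ ∀' (∀' ((α⇒β ⇒ α⇒β) ⇒ α⇒β))
⊢fix = ⊢Λ (⊢val (⊢Λ (⊢val (⊢ƛ (⊢app ⊢δV (⊢val (⊢inj refl ⊢δV)))))))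

⊢fix-app : ∀ {τ τ' f} → [] ⊢v f ∶ ((τ ⇒ τ') ⇒ (τ ⇒ τ')) → [] ⊢ fix[ τ ][ τ' ] f ∶ (τ ⇒ τ')
⊢fix-app {τ} {τ'} {f} ⊢f =
  subst (λ t → [] ⊢ fix[ τ ][ τ' ] f ∶ t) (cong₂ _⇒_ α-inst β-inst)
    (⊢app (⊢ƛ (⊢app (⊢ƛ (⊢app (⊢var zero) (⊢val ⊢f-weakened))) (⊢tapp β (⊢var zero))))
          (⊢tapp τ ⊢fix))
  where
  β : Ty 0
  β = renT (λ ()) τ'
  α : Ty 0
  α = (renT suc τ) [ β ]T
  α-inst : α ≡ τ
  α-inst = wk-single τ β
  β-inst : β ≡ τ'
  β-inst = renT-id (λ ()) (λ ()) τ'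
  ⊢f-weakened : ∀ {m} {Γ : Ctx 0 m} → Γ ⊢v weaken0 f ∶ ((α ⇒ β) ⇒ (α ⇒ β))
  ⊢f-weakened = subst₂ (λ a b → _ ⊢v weaken0 f ∶ ((a ⇒ b) ⇒ (a ⇒ b))) (sym α-inst) (sym β-inst) (closed⊢v ⊢f)

⊢letApp : ∀ {e a b} → [] ⊢ e ∶ (a ⇒ b) → [] ⊢v letApp e ∶ (a ⇒ b)
⊢letApp {e} {a} {b} ⊢e =
  ⊢ƛ (⊢app (⊢ƛ (⊢app (⊢var zero) (⊢val (⊢var (suc zero))))) (closed⊢ ⊢tsub-e))
  where
  ⊢tsub-e : [] ⊢ tsubE (λ ()) e ∶ (a ⇒ b)
  ⊢tsub-e = subst ([] ⊢ tsubE (λ ()) e ∶_) (subT-id (λ ()) (λ ()) (a ⇒ b)) (tsub⊢ (λ ()) ⊢e)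

-- g_f = λx. let r = Ω_f in r x has the type of fix f, since Ω_f is a reduct of fix f.
⊢g : ∀ {τ τ' f} → [] ⊢v f ∶ ((τ ⇒ τ') ⇒ (τ ⇒ τ')) → [] ⊢v letApp (Ω f) ∶ (τ ⇒ τ')
⊢g {τ} {τ'} {f} ⊢f = ⊢letApp (preservation* (fix-unfolds τ τ' f) (⊢fix-app ⊢f))

-- The heart of the proof: if f g_f ⇝p λx.e then f (fix f) ≈ fix f, via
--   f (fix f)  ⊒  f (λx.e)                 (pure-run: fix f ⇝p Ω_f ⇝p f g_f ⇝p λx.e)
--              ⊑  f (letApp (val (λx.e)))  (let-η)
--              ⊑  f g_f                    (pure-arg: Ω_f ⇝p λx.e inside g_f)
--              ⊑  fix f                    (pure-run: fix f ⇝p f g_f).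
fix-≈ : (τ τ' : Ty 0) (f : Val 0 0) (eW : Tm 0 1) → app f (val (letApp (Ω f))) ⇝p val (ƛ eW) →
  app f (fix[ τ ][ τ' ] f) ≈ fix[ τ ][ τ' ] f
fix-≈ τ τ' f eW f-g⇝λ = fwd step₁ ◅ bwd step₂ ◅ bwd step₃ ◅ bwd step₄ ◅ ε
  where
  fix⇝fg : (fix[ τ ][ τ' ] f) ⇝p app f (val (letApp (Ω f)))
  fix⇝fg = fix-unfolds τ τ' f ◅◅ Ω-unfolds f
  closed : ∀ {e} → e ≡ emb e
  closed = sym (emb-closed _)
  step₁ : app f (fix[ τ ][ τ' ] f) ⊒ app f (val (ƛ eW))
  step₁ = pure-run _ _ (ξ* (fix⇝fg ◅◅ f-g⇝λ)) (λ ()) closed closed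
  step₂ : app f (val (letApp (val (ƛ eW)))) ⊒ app f (val (ƛ eW))
  step₂ = ⊒app (⊒v-refl f) (⊒val (let-η eW (sym (embV-closed _)) (sym (embV-closed _))))
  step₃ : app f (val (letApp (Ω f))) ⊒ app f (val (letApp (val (ƛ eW))))
  step₃ = ⊒app (⊒v-refl f)
    (⊒val (⊒ƛ (pure-arg (⊒v-refl applyArg) (Ω f) (ƛ eW) (Ω-unfolds f ◅◅ f-g⇝λ) refl refl)))
  step₄ : fix[ τ ][ τ' ] f ⊒ app f (val (letApp (Ω f)))
  step₄ = pure-run _ _ fix⇝fg (λ ()) closed closed

proposition6p1 : (τ τ' : Ty 0) (f : Val 0 0) →
    [] ⊢v f ∶ ((τ ⇒ τ') ⇒ (τ ⇒ τ')) →
    ((g : Val 0 0) → [] ⊢v g ∶ (τ ⇒ τ') → Σ (Val 0 0) (λ fg → app f (val g) ⇝p val fg)) →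
    ([] ⊢ app f (fix[ τ ][ τ' ] f) ≅⇓ fix[ τ ][ τ' ] f ∶ (τ ⇒ τ'))
      × ([] ⊢ app f (fix[ τ ][ τ' ] f) ≅↓ fix[ τ ][ τ' ] f ∶ (τ ⇒ τ'))
proposition6p1 τ τ' f ⊢f f-converges with f-converges (letApp (Ω f)) (⊢g ⊢f)
... | fg , f-g⇝fg with canonical-⇒ (⊢val⁻ (preservation* f-g⇝fg (⊢app ⊢f (⊢val (⊢g ⊢f)))))
...   | eW , refl = ≈⇒≅ (⊢app ⊢f (⊢fix-app ⊢f)) (⊢fix-app ⊢f) (fix-≈ τ τ' f eW f-g⇝fg)
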